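{- Let $K$ be a set and let $\mathsf{CW}_K$ be the category whose objects are the syntactic propositions over $K$ and whose morphisms $(X,S)\to(Y,T)$ are the binary relations $R\subseteq X\times Y$ that respect labels and satisfy the resolution condition: for every $t\in T$, $R^{ -1}(t)=\{x:\exists y\in t,\ xRy\}\in S$, and for every $\alpha\in S^{\perp}$, $R(\alpha)=\{y:\exists x\in\alpha,\ xRy\}\in T^{\perp}$; composition is relational composition. Then $\mathsf{CW}_K$ is the free category with binary products and binary sums (coproducts) generated by the set $K$, in the standard 2-categorical sense of freeness (with the generator $k\in K$ corresponding to the proposition with a single leaf labelled $k$ and resolution set $\{\{x\}\}$).
   Context: For subsets $s,t$ of a set $X$, $s\perp t$ means $s\cap t$ has exactly one element; for a set $S$ of subsets of $X$, $S^{\perp}=\{t\subseteq X: t\perp s\ \forall s\in S\}$. An abstract proposition with labels in $K$ is a pair $(X,S)$ with $X$ a set of leaves labelled by elements of $K$ and $S$ a set of subsets of $X$ (resolutions) with $S^{\perp\perp}=S$. A syntactic proposition arises from a formula $\phi$ built from elements of $K$ with binary $\wedge,\vee$ (no constants): $X$ is the set of leaf occurrences of $\phi$, and $S$ the set of maximal sets of leaves no two of which meet at a $\wedge$-node of the parse tree. In $\mathsf{CW}_K$, the sum of $(X,S)$ and $(Y,T)$ is $(X+Y,\{s+t: s\in S,t\in T\})$ and the product is $(X+Y, S\cup T)$ (resolutions of either component, viewed in the disjoint union). -}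

module Defs where

open import Level using (Level; _⊔_; 0ℓ) renaming (suc to lsuc)
open import Data.Bool using (Bool; true; false; _∧_)
open import Data.List using (List; []; _∷_; _++_; map)
open import Data.Bool.ListAction using (any)
open import Data.Product using (Σ; _×_; _,_; Σ-syntax)
open import Data.Empty using (⊥)
open import Relation.Binary.PropositionalEquality using (_≡_)
open import Relation.Binary.Structures using (IsEquivalence)

record Category (o ℓ e : Level) : Set (lsuc (o ⊔ ℓ ⊔ e)) where
  infixr 9 _∘_
  infix  4 _≈_
  field
    Obj       : Set o
    _⇒_       : Obj → Obj → Set ℓ
    _≈_       : ∀ {A B} → A ⇒ B → A ⇒ B → Set e
    id        : ∀ {A} → A ⇒ A
    _∘_       : ∀ {A B C} → B ⇒ C → A ⇒ B → A ⇒ C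
    equiv     : ∀ {A B} → IsEquivalence (_≈_ {A} {B})
    ∘-resp-≈  : ∀ {A B C} {f h : B ⇒ C} {g i : A ⇒ B} → f ≈ h → g ≈ i → f ∘ g ≈ h ∘ i
    identityˡ : ∀ {A B} {f : A ⇒ B} → id ∘ f ≈ f
    identityʳ : ∀ {A B} {f : A ⇒ B} → f ∘ id ≈ f
    assoc     : ∀ {A B C D} {f : A ⇒ B} {g : B ⇒ C} {h : C ⇒ D} →
                (h ∘ g) ∘ f ≈ h ∘ (g ∘ f)

module _ {o ℓ e} (C : Category o ℓ e) where
  open Category C

  IsProduct : ∀ {A B P} → P ⇒ A → P ⇒ B → Set (o ⊔ ℓ ⊔ e)
  IsProduct {A} {B} {P} π₁ π₂ =
    ∀ {X} (f : X ⇒ A) (g : X ⇒ B) →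
      Σ[ h ∈ X ⇒ P ] ((π₁ ∘ h ≈ f) × (π₂ ∘ h ≈ g) ×
        (∀ (h' : X ⇒ P) → π₁ ∘ h' ≈ f → π₂ ∘ h' ≈ g → h' ≈ h))

  IsCoproduct : ∀ {A B Q} → A ⇒ Q → B ⇒ Q → Set (o ⊔ ℓ ⊔ e)
  IsCoproduct {A} {B} {Q} ι₁ ι₂ =
    ∀ {X} (f : A ⇒ X) (g : B ⇒ X) →
      Σ[ h ∈ Q ⇒ X ] ((h ∘ ι₁ ≈ f) × (h ∘ ι₂ ≈ g) ×
        (∀ (h' : Q ⇒ X) → h' ∘ ι₁ ≈ f → h' ∘ ι₂ ≈ g → h' ≈ h))

  HasBinaryProducts : Set (o ⊔ ℓ ⊔ e)
  HasBinaryProducts = ∀ A B →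
    Σ[ P ∈ Obj ] Σ[ π₁ ∈ P ⇒ A ] Σ[ π₂ ∈ P ⇒ B ] IsProduct π₁ π₂

  HasBinaryCoproducts : Set (o ⊔ ℓ ⊔ e)
  HasBinaryCoproducts = ∀ A B →
    Σ[ Q ∈ Obj ] Σ[ ι₁ ∈ A ⇒ Q ] Σ[ ι₂ ∈ B ⇒ Q ] IsCoproduct ι₁ ι₂

  Iso : Obj → Obj → Set (ℓ ⊔ e)
  Iso A B = Σ[ f ∈ A ⇒ B ] Σ[ g ∈ B ⇒ A ] ((f ∘ g ≈ id) × (g ∘ f ≈ id))

record Functor {o ℓ e o' ℓ' e'} (C : Category o ℓ e) (D : Category o' ℓ' e')
       : Set (o ⊔ ℓ ⊔ e ⊔ o' ⊔ ℓ' ⊔ e') where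
  private
    module C = Category C
    module D = Category D
  field
    F₀           : C.Obj → D.Obj
    F₁           : ∀ {A B} → A C.⇒ B → F₀ A D.⇒ F₀ B
    F-resp-≈     : ∀ {A B} {f g : A C.⇒ B} → f C.≈ g → F₁ f D.≈ F₁ g
    identity     : ∀ {A} → F₁ (C.id {A}) D.≈ D.id
    homomorphism : ∀ {A B C'} {f : A C.⇒ B} {g : B C.⇒ C'} →
                   F₁ (g C.∘ f) D.≈ F₁ g D.∘ F₁ f

record PPFunctor {o ℓ e o' ℓ' e'} (C : Category o ℓ e) (D : Category o' ℓ' e')
       : Set (o ⊔ ℓ ⊔ e ⊔ o' ⊔ ℓ' ⊔ e') where
  private
    module C = Category C
  field
    functor : Functor C D
  open Functor functor public
  field
    pres-prod   : ∀ {A B P} {π₁ : P C.⇒ A} {π₂ : P C.⇒ B} →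
                  IsProduct C π₁ π₂ → IsProduct D (F₁ π₁) (F₁ π₂)
    pres-coprod : ∀ {A B Q} {ι₁ : A C.⇒ Q} {ι₂ : B C.⇒ Q} →
                  IsCoproduct C ι₁ ι₂ → IsCoproduct D (F₁ ι₁) (F₁ ι₂)

record NatTrans {o ℓ e o' ℓ' e'} {C : Category o ℓ e} {D : Category o' ℓ' e'}
       (F G : PPFunctor C D) : Set (o ⊔ ℓ ⊔ ℓ' ⊔ e') where
  private
    module C = Category C
    module D = Category D
    module F = PPFunctor F
    module G = PPFunctor G
  field
    η       : ∀ A → F.F₀ A D.⇒ G.F₀ A
    commute : ∀ {A B} (f : A C.⇒ B) → η B D.∘ F.F₁ f D.≈ G.F₁ f D.∘ η A

open NatTrans public

-- A category G with a map gen : K → Obj G is the free category with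
-- binary products and binary coproducts on K (2-categorical sense):
-- G has binary products and coproducts, and for every category C (at the
-- given levels) with binary products and coproducts, restriction along gen
--   PP(G, C)  →  C^K     (product-and-coproduct preserving functors,
--                         natural transformations  →  K-indexed families)
-- is an equivalence of categories, i.e. essentially surjective, full and
-- faithful.
IsFreeProdCoprod : ∀ {o₀ ℓ₀ e₀} (o ℓ e : Level) {K : Set} (G : Category o₀ ℓ₀ e₀)
                   (gen : K → Category.Obj G) → Set (lsuc (o ⊔ ℓ ⊔ e) ⊔ o₀ ⊔ ℓ₀ ⊔ e₀)
IsFreeProdCoprod o ℓ e {K} G gen =
  HasBinaryProducts G × HasBinaryCoproducts G ×
  (∀ (C : Category o ℓ e) → HasBinaryProducts C → HasBinaryCoproducts C →
    let open Category C in
    (∀ (f : K → Obj) →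
       Σ[ F ∈ PPFunctor G C ] (∀ k → Iso C (PPFunctor.F₀ F (gen k)) (f k)))
    ×
    (∀ (F F' : PPFunctor G C)
       (h : ∀ k → PPFunctor.F₀ F (gen k) ⇒ PPFunctor.F₀ F' (gen k)) →
       Σ[ α ∈ NatTrans F F' ] (∀ k → η α (gen k) ≈ h k))
    ×
    (∀ (F F' : PPFunctor G C) (α β : NatTrans F F') →
       (∀ k → η α (gen k) ≈ η β (gen k)) →
       ∀ A → η α A ≈ η β A))

data Conn : Set where
  ∧c ∨c : Conn

data Formula (K : Set) : Set where
  atom : K → Formula K
  node : Conn → Formula K → Formula K → Formula K

module _ {K : Set} where

  -- leaf occurrences (the set X of the syntactic proposition)
  data Leaf : Formula K → Set where
    here  : ∀ {k} → Leaf (atom k)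
    left  : ∀ {c φ ψ} → Leaf φ → Leaf (node c φ ψ)
    right : ∀ {c φ ψ} → Leaf ψ → Leaf (node c φ ψ)

  label : ∀ {φ} → Leaf φ → K
  label (here {k}) = k
  label (left x)   = label x
  label (right x)  = label x

  allLeaves : ∀ φ → List (Leaf φ)
  allLeaves (atom k)     = here ∷ []
  allLeaves (node c φ ψ) = map left (allLeaves φ) ++ map right (allLeaves ψ)

  eqLeaf : ∀ {φ} → Leaf φ → Leaf φ → Bool
  eqLeaf here      here      = true
  eqLeaf (left x)  (left y)  = eqLeaf x y
  eqLeaf (right x) (right y) = eqLeaf x y
  eqLeaf _         _         = false

  -- x and y meet (lowest common ancestor) at a ∧-node of the parse tree
  data MeetAtAnd : ∀ {φ} → Leaf φ → Leaf φ → Set where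
    lr : ∀ {φ ψ} {x : Leaf φ} {y : Leaf ψ} → MeetAtAnd (left {∧c} x) (right y)
    rl : ∀ {φ ψ} {x : Leaf φ} {y : Leaf ψ} → MeetAtAnd (right {∧c} y) (left x)
    ll : ∀ {c φ ψ} {x y : Leaf φ} → MeetAtAnd x y → MeetAtAnd (left {c} {φ} {ψ} x) (left y)
    rr : ∀ {c φ ψ} {x y : Leaf ψ} → MeetAtAnd x y → MeetAtAnd (right {c} {φ} {ψ} x) (right y)

  Subset : Formula K → Set
  Subset φ = Leaf φ → Bool

  _⊆_ : ∀ {φ} → Subset φ → Subset φ → Set
  s ⊆ s' = ∀ x → s x ≡ true → s' x ≡ true

  Independent : ∀ {φ} → Subset φ → Set
  Independent s = ∀ x y → s x ≡ true → s y ≡ true → MeetAtAnd x y → ⊥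

  IsResolution : ∀ φ → Subset φ → Set
  IsResolution φ s = Independent s × (∀ s' → s ⊆ s' → Independent s' → s' ⊆ s)

  _⊥ˢ_ : ∀ {φ} → Subset φ → Subset φ → Set
  s ⊥ˢ t = Σ[ x ∈ _ ] (s x ≡ true × t x ≡ true ×
             (∀ y → s y ≡ true → t y ≡ true → y ≡ x))

  InPerp : ∀ φ → Subset φ → Set
  InPerp φ α = ∀ s → IsResolution φ s → α ⊥ˢ s

  Rel : Formula K → Formula K → Set
  Rel φ ψ = Leaf φ → Leaf ψ → Bool

  preimage : ∀ {φ ψ} → Rel φ ψ → Subset ψ → Subset φ
  preimage {ψ = ψ} R t x = any (λ y → t y ∧ R x y) (allLeaves ψ)

  image : ∀ {φ ψ} → Rel φ ψ → Subset φ → Subset ψ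
  image {φ = φ} R α y = any (λ x → α x ∧ R x y) (allLeaves φ)

  RespectsLabels : ∀ {φ ψ} → Rel φ ψ → Set
  RespectsLabels R = ∀ x y → R x y ≡ true → label x ≡ label y

  ResolutionCondition : ∀ {φ ψ} → Rel φ ψ → Set
  ResolutionCondition {φ} {ψ} R =
    (∀ t → IsResolution ψ t → IsResolution φ (preimage R t)) ×
    (∀ α → InPerp φ α → InPerp ψ (image R α))

  idRel : ∀ {φ} → Rel φ φ
  idRel = eqLeaf

  compRel : ∀ {φ ψ χ} → Rel φ ψ → Rel ψ χ → Rel φ χ
  compRel {ψ = ψ} R R' x z = any (λ y → R x y ∧ R' y z) (allLeaves ψ)

  _≈R_ : ∀ {φ ψ} → Rel φ ψ → Rel φ ψ → Set
  R ≈R R' = ∀ x y → R x y ≡ R' x y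

  record Hom (φ ψ : Formula K) : Set where
    field
      rel     : Rel φ ψ
      labels  : RespectsLabels rel
      resCond : ResolutionCondition rel
  open Hom public

-- The facts needed to see that CW_K (with the above data) is a category.
-- They are asserted (not assumed) by the main theorem.
record CWFacts (K : Set) : Set₁ where
  field
    id-labels   : ∀ {φ : Formula K} → RespectsLabels (idRel {φ = φ})
    id-res      : ∀ {φ : Formula K} → ResolutionCondition (idRel {φ = φ})
    comp-labels : ∀ {φ ψ χ : Formula K} (R : Rel φ ψ) (R' : Rel ψ χ) →
                  RespectsLabels R → RespectsLabels R' → RespectsLabels (compRel R R')
    comp-res    : ∀ {φ ψ χ : Formula K} (R : Rel φ ψ) (R' : Rel ψ χ) →
                  ResolutionCondition R → ResolutionCondition R' →
                  ResolutionCondition (compRel R R')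
    ≈R-equiv    : ∀ {φ ψ : Formula K} → IsEquivalence (_≈R_ {φ = φ} {ψ = ψ})
    comp-resp   : ∀ {φ ψ χ : Formula K} {R S : Rel φ ψ} {R' S' : Rel ψ χ} →
                  R ≈R S → R' ≈R S' → compRel R R' ≈R compRel S S'
    comp-idˡ    : ∀ {φ ψ : Formula K} (R : Rel φ ψ) → compRel R idRel ≈R R
    comp-idʳ    : ∀ {φ ψ : Formula K} (R : Rel φ ψ) → compRel idRel R ≈R R
    comp-assoc  : ∀ {φ ψ χ ω : Formula K} (R : Rel φ ψ) (R' : Rel ψ χ) (R'' : Rel χ ω) →
                  compRel R (compRel R' R'') ≈R compRel (compRel R R') R''

CW : (K : Set) → CWFacts K → Category 0ℓ 0ℓ 0ℓ
CW K fc = record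
  { Obj       = Formula K
  ; _⇒_       = Hom
  ; _≈_       = λ f g → rel f ≈R rel g
  ; id        = record { rel = idRel ; labels = id-labels ; resCond = id-res }
  ; _∘_       = λ g f → record
      { rel     = compRel (rel f) (rel g)
      ; labels  = comp-labels (rel f) (rel g) (labels f) (labels g)
      ; resCond = comp-res (rel f) (rel g) (resCond f) (resCond g) }
  ; equiv     = record
      { refl  = IsEquivalence.refl ≈R-equiv
      ; sym   = IsEquivalence.sym ≈R-equiv
      ; trans = IsEquivalence.trans ≈R-equiv }
  ; ∘-resp-≈  = λ p q → comp-resp q p
  ; identityˡ = λ {_} {_} {f} → comp-idˡ (rel f)
  ; identityʳ = λ {_} {_} {f} → comp-idʳ (rel f)
  ; assoc     = λ {_} {_} {_} {_} {f} {g} {h} → comp-assoc (rel f) (rel g) (rel h)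
  }
  where open CWFacts fc

gen : {K : Set} → K → Formula K
gen = atom

{-# OPTIONS --safe #-}
-- Morphisms of CW_K are exactly the linkings of cut-free sequent derivations φ ⊢ ψ with the
-- rules ax, ∧R, ∨L, ∧L₁, ∧L₂, ∨R₁, ∨R₂.  Every linking satisfies the resolution condition;
-- conversely (sequentialisation) a morphism splits along an ∧ on the right or an ∨ on the
-- left, and otherwise the resolution condition forces one side of the ∧ on the left or of the
-- ∨ on the right to be unused.  Cut elimination computes relational composition.  In a category
-- with products and coproducts every derivation has an evident interpretation, and derivations
-- with the same linking have the same interpretation (coherence, by the same case analysis), so
-- interpreting a morphism through any of its derivations gives a product- and
-- coproduct-preserving functor extending any assignment of objects to K.  Natural
-- transformations between such functors are determined by, and extend uniquely from, their
-- components at the generators, by the universal properties of products and coproducts.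
module Submission where

open import Defs
open import Level using (Level)
open import Data.Bool using (Bool; true; false; _∧_; _∨_)
open import Data.Bool.Properties using (∨-zeroʳ; ∨-identityʳ; ∧-zeroʳ)
open import Data.List using (List; []; _∷_; _++_; map)
open import Data.Bool.ListAction using (any)
open import Data.Product using (Σ; ∃; _×_; _,_; proj₁; proj₂)
open import Data.Sum using (_⊎_; inj₁; inj₂)
open import Data.Empty using (⊥; ⊥-elim)
open import Relation.Binary.PropositionalEquality
  using (_≡_; refl; sym; trans; cong; cong₂; subst; module ≡-Reasoning)
open import Relation.Binary.Structures using (IsEquivalence)

private variable
  o ℓ e o′ ℓ′ e′ : Level

true-false-absurd : ∀ {a} → a ≡ true → a ≡ false → ⊥
true-false-absurd refl ()

false≢true : false ≡ true → ⊥
false≢true ()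

≢true⇒≡false : ∀ {a} → (a ≡ true → ⊥) → a ≡ false
≢true⇒≡false {true}  a≢true = ⊥-elim (a≢true refl)
≢true⇒≡false {false} _      = refl

∨-true⁻¹ : ∀ {a b} → a ∨ b ≡ true → a ≡ true ⊎ b ≡ true
∨-true⁻¹ {true}  _ = inj₁ refl
∨-true⁻¹ {false} p = inj₂ p

∧-true⁻¹ : ∀ {a b} → a ∧ b ≡ true → a ≡ true × b ≡ true
∧-true⁻¹ {true} {true} _ = refl , refl

∧-true : ∀ {a b} → a ≡ true → b ≡ true → a ∧ b ≡ true
∧-true refl refl = refl

≡-from-true⇔true : ∀ {a b} → (a ≡ true → b ≡ true) → (b ≡ true → a ≡ true) → a ≡ b
≡-from-true⇔true {true}  {true}  _ _ = refl
≡-from-true⇔true {true}  {false} f _ = sym (f refl)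
≡-from-true⇔true {false} {true}  _ g = g refl
≡-from-true⇔true {false} {false} _ _ = refl

any-++ : ∀ {A : Set} (p : A → Bool) (xs ys : List A) → any p (xs ++ ys) ≡ any p xs ∨ any p ys
any-++ p []       ys = refl
any-++ p (x ∷ xs) ys with p x
... | true  = refl
... | false = any-++ p xs ys

any-map : ∀ {A B : Set} (p : B → Bool) (f : A → B) (xs : List A) →
          any p (map f xs) ≡ any (λ x → p (f x)) xs
any-map p f []       = refl
any-map p f (x ∷ xs) = cong (p (f x) ∨_) (any-map p f xs)

-- Categories, products and coproducts

op : Category o ℓ e → Category o ℓ e
op C = record
  { Obj = Obj ; _⇒_ = λ A B → B ⇒ A ; _≈_ = _≈_ ; id = id ; _∘_ = λ f g → g ∘ f
  ; equiv = equiv ; ∘-resp-≈ = λ f≈h g≈i → ∘-resp-≈ g≈i f≈h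
  ; identityˡ = identityʳ ; identityʳ = identityˡ
  ; assoc = IsEquivalence.sym equiv assoc }
  where open Category C

op-functor : ∀ {C : Category o ℓ e} {D : Category o′ ℓ′ e′} → Functor C D → Functor (op C) (op D)
op-functor F = record
  { F₀ = F₀ ; F₁ = F₁ ; F-resp-≈ = F-resp-≈ ; identity = identity ; homomorphism = homomorphism }
  where open Functor F

module CategoryProperties (C : Category o ℓ e) where
  open Category C public
  module ≈ {A B} = IsEquivalence (equiv {A} {B})

  infixr 5 _∙_
  _∙_ : ∀ {A B} {f g h : A ⇒ B} → f ≈ g → g ≈ h → f ≈ h
  _∙_ = ≈.trans

  ∘-resp-≈ˡ : ∀ {A B D} {f h : B ⇒ D} {g : A ⇒ B} → f ≈ h → f ∘ g ≈ h ∘ g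
  ∘-resp-≈ˡ f≈h = ∘-resp-≈ f≈h ≈.refl

  ∘-resp-≈ʳ : ∀ {A B D} {f : B ⇒ D} {g i : A ⇒ B} → g ≈ i → f ∘ g ≈ f ∘ i
  ∘-resp-≈ʳ g≈i = ∘-resp-≈ ≈.refl g≈i

  sym-assoc : ∀ {A B D E} {f : A ⇒ B} {g : B ⇒ D} {h : D ⇒ E} → h ∘ (g ∘ f) ≈ (h ∘ g) ∘ f
  sym-assoc = ≈.sym assoc

  ∘-resp-factorisations : ∀ {P X Y Z} {a : X ⇒ Y} {π : P ⇒ X} {ι : Z ⇒ Y} {a' b' : X ⇒ Z} {b : P ⇒ Z} →
    a ≈ ι ∘ a' → b ≈ b' ∘ π → a' ≈ b' → a ∘ π ≈ ι ∘ b
  ∘-resp-factorisations a≈ b≈ a'≈b' =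
    ∘-resp-≈ˡ a≈ ∙ assoc ∙ ∘-resp-≈ʳ (∘-resp-≈ˡ a'≈b' ∙ ≈.sym b≈)

  Iso-refl : ∀ {A} → Iso C A A
  Iso-refl = id , id , identityˡ , identityˡ

  module _ {A B P} {π₁ : P ⇒ A} {π₂ : P ⇒ B} (isProduct : IsProduct C π₁ π₂) where

    IsProduct-ext : ∀ {X} (h h' : X ⇒ P) → π₁ ∘ h ≈ π₁ ∘ h' → π₂ ∘ h ≈ π₂ ∘ h' → h ≈ h'
    IsProduct-ext h h' eq₁ eq₂ =
      let (_ , _ , _ , unique) = isProduct (π₁ ∘ h') (π₂ ∘ h') in
      unique h eq₁ eq₂ ∙ ≈.sym (unique h' ≈.refl ≈.refl)

    IsProduct-resp-≈ : ∀ {π₁′ : P ⇒ A} {π₂′ : P ⇒ B} → π₁ ≈ π₁′ → π₂ ≈ π₂′ → IsProduct C π₁′ π₂′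
    IsProduct-resp-≈ π₁≈ π₂≈ f g with isProduct f g
    ... | h , β₁ , β₂ , unique =
      h , ∘-resp-≈ˡ (≈.sym π₁≈) ∙ β₁ , ∘-resp-≈ˡ (≈.sym π₂≈) ∙ β₂ ,
      λ h' eq₁ eq₂ → unique h' (∘-resp-≈ˡ π₁≈ ∙ eq₁) (∘-resp-≈ˡ π₂≈ ∙ eq₂)

    IsProduct-∘-iso : ∀ {Q} (u : Q ⇒ P) (v : P ⇒ Q) → u ∘ v ≈ id → v ∘ u ≈ id →
                      IsProduct C (π₁ ∘ u) (π₂ ∘ u)
    IsProduct-∘-iso u v uv≈id vu≈id f g with isProduct f g
    ... | h , β₁ , β₂ , unique =
      v ∘ h ,
      assoc ∙ ∘-resp-≈ʳ (sym-assoc ∙ ∘-resp-≈ˡ uv≈id ∙ identityˡ) ∙ β₁ ,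
      assoc ∙ ∘-resp-≈ʳ (sym-assoc ∙ ∘-resp-≈ˡ uv≈id ∙ identityˡ) ∙ β₂ ,
      λ h' eq₁ eq₂ → ≈.sym identityˡ ∙ ∘-resp-≈ˡ (≈.sym vu≈id) ∙ assoc
                     ∙ ∘-resp-≈ʳ (unique (u ∘ h') (sym-assoc ∙ eq₁) (sym-assoc ∙ eq₂))

  IsProduct-unique-up-to-iso : ∀ {A B P Q} {π₁ : P ⇒ A} {π₂ : P ⇒ B} {q₁ : Q ⇒ A} {q₂ : Q ⇒ B} →
    IsProduct C π₁ π₂ → IsProduct C q₁ q₂ →
    Σ (Q ⇒ P) λ u → Σ (P ⇒ Q) λ v → (u ∘ v ≈ id) × (v ∘ u ≈ id) × (π₁ ∘ u ≈ q₁) × (π₂ ∘ u ≈ q₂)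
  IsProduct-unique-up-to-iso {π₁ = π₁} {π₂} {q₁} {q₂} isP isQ with isP q₁ q₂ | isQ π₁ π₂
  ... | u , πu₁ , πu₂ , _ | v , qv₁ , qv₂ , _ =
    u , v ,
    IsProduct-ext isP (u ∘ v) id (sym-assoc ∙ ∘-resp-≈ˡ πu₁ ∙ qv₁ ∙ ≈.sym identityʳ)
                                 (sym-assoc ∙ ∘-resp-≈ˡ πu₂ ∙ qv₂ ∙ ≈.sym identityʳ) ,
    IsProduct-ext isQ (v ∘ u) id (sym-assoc ∙ ∘-resp-≈ˡ qv₁ ∙ πu₁ ∙ ≈.sym identityʳ)
                                 (sym-assoc ∙ ∘-resp-≈ˡ qv₂ ∙ πu₂ ∙ ≈.sym identityʳ) ,
    πu₁ , πu₂

module FunctorProperties {C : Category o ℓ e} {D : Category o′ ℓ′ e′} (F : Functor C D) where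
  private
    module C = CategoryProperties C
    module D = CategoryProperties D
  open Functor F

  F-resp-inverse : ∀ {A B} {u : A C.⇒ B} {v : B C.⇒ A} → u C.∘ v C.≈ C.id → F₁ u D.∘ F₁ v D.≈ D.id
  F-resp-inverse uv≈id = D.≈.sym homomorphism D.∙ F-resp-≈ uv≈id D.∙ identity

  -- Products are unique up to isomorphism, so preserving one product of each pair suffices.
  preservesProducts : (products : HasBinaryProducts C) →
    (∀ A B → let (_ , π₁ , π₂ , _) = products A B in IsProduct D (F₁ π₁) (F₁ π₂)) →
    ∀ {A B Q} {q₁ : Q C.⇒ A} {q₂ : Q C.⇒ B} → IsProduct C q₁ q₂ → IsProduct D (F₁ q₁) (F₁ q₂)
  preservesProducts products preserved {A} {B} isQ =
    let (P , π₁ , π₂ , isP) = products A B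
        (u , v , uv≈id , vu≈id , πu₁ , πu₂) = C.IsProduct-unique-up-to-iso isP isQ
    in D.IsProduct-resp-≈ (D.IsProduct-∘-iso (preserved A B) (F₁ u) (F₁ v)
                            (F-resp-inverse uv≈id) (F-resp-inverse vu≈id))
         (D.≈.sym homomorphism D.∙ F-resp-≈ πu₁) (D.≈.sym homomorphism D.∙ F-resp-≈ πu₂)

module _ {K : Set} where

  private variable
    c : Conn
    φ ψ χ ω φ₁ φ₂ ψ₁ ψ₂ : Formula K

  -- Resolutions

  -- Unlike `any p (allLeaves φ)` from Defs, this reduces definitionally on `node`.
  anyLeaf : (φ : Formula K) → (Leaf φ → Bool) → Bool
  anyLeaf (atom k)     p = p here
  anyLeaf (node c φ ψ) p = anyLeaf φ (λ x → p (left x)) ∨ anyLeaf ψ (λ y → p (right y))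

  IsEmpty : Subset φ → Set
  IsEmpty s = ∀ x → s x ≡ false

  any-allLeaves : ∀ (φ : Formula K) (p : Leaf φ → Bool) → any p (allLeaves φ) ≡ anyLeaf φ p
  any-allLeaves (atom k) p = ∨-identityʳ (p here)
  any-allLeaves (node c φ ψ) p = begin
    any p (map left (allLeaves φ) ++ map right (allLeaves ψ))
      ≡⟨ any-++ p (map left (allLeaves φ)) (map right (allLeaves ψ)) ⟩
    any p (map left (allLeaves φ)) ∨ any p (map right (allLeaves ψ))
      ≡⟨ cong₂ _∨_ (trans (any-map p left (allLeaves φ)) (any-allLeaves φ _))
                   (trans (any-map p right (allLeaves ψ)) (any-allLeaves ψ _)) ⟩
    anyLeaf (node c φ ψ) p ∎
    where open ≡-Reasoning

  anyLeaf-intro : ∀ (φ : Formula K) (p : Leaf φ → Bool) x → p x ≡ true → anyLeaf φ p ≡ true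
  anyLeaf-intro (atom k)     p here      px = px
  anyLeaf-intro (node c φ ψ) p (left x)  px =
    cong (_∨ anyLeaf ψ (λ y → p (right y))) (anyLeaf-intro φ _ x px)
  anyLeaf-intro (node c φ ψ) p (right y) py =
    trans (cong (anyLeaf φ _ ∨_) (anyLeaf-intro ψ _ y py)) (∨-zeroʳ _)

  anyLeaf-elim : ∀ (φ : Formula K) (p : Leaf φ → Bool) → anyLeaf φ p ≡ true → ∃ λ x → p x ≡ true
  anyLeaf-elim (atom k)     p e = here , e
  anyLeaf-elim (node c φ ψ) p e with ∨-true⁻¹ {anyLeaf φ (λ x → p (left x))} e
  ... | inj₁ e' = let (x , px) = anyLeaf-elim φ _ e' in left x , px
  ... | inj₂ e' = let (y , py) = anyLeaf-elim ψ _ e' in right y , py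

  anyLeaf-false : ∀ (φ : Formula K) (p : Leaf φ → Bool) → IsEmpty p → anyLeaf φ p ≡ false
  anyLeaf-false φ p p-empty =
    ≢true⇒≡false λ e → let (x , px) = anyLeaf-elim φ p e in true-false-absurd px (p-empty x)

  anyLeaf-false⁻¹ : ∀ (φ : Formula K) (p : Leaf φ → Bool) → anyLeaf φ p ≡ false → IsEmpty p
  anyLeaf-false⁻¹ φ p e x = ≢true⇒≡false λ px → true-false-absurd (anyLeaf-intro φ p x px) e

  anyLeaf-cong : ∀ (φ : Formula K) {p q : Leaf φ → Bool} → (∀ x → p x ≡ q x) → anyLeaf φ p ≡ anyLeaf φ q
  anyLeaf-cong (atom k)     p≗q = p≗q here
  anyLeaf-cong (node c φ ψ) p≗q =
    cong₂ _∨_ (anyLeaf-cong φ (λ x → p≗q (left x))) (anyLeaf-cong ψ (λ y → p≗q (right y)))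

  anyLeaf-∧-intro : ∀ (φ : Formula K) (p q : Leaf φ → Bool) x → p x ≡ true → q x ≡ true →
                    anyLeaf φ (λ x → p x ∧ q x) ≡ true
  anyLeaf-∧-intro φ p q x px qx = anyLeaf-intro φ _ x (∧-true px qx)

  anyLeaf-∧-elim : ∀ (φ : Formula K) (p q : Leaf φ → Bool) → anyLeaf φ (λ x → p x ∧ q x) ≡ true →
                   ∃ λ x → p x ≡ true × q x ≡ true
  anyLeaf-∧-elim φ p q e = let (x , pqx) = anyLeaf-elim φ _ e in x , ∧-true⁻¹ pqx

  anyLeaf? : ∀ (φ : Formula K) (p : Leaf φ → Bool) → (∃ λ x → p x ≡ true) ⊎ IsEmpty p
  anyLeaf? φ p with anyLeaf φ p in e
  ... | true  = inj₁ (anyLeaf-elim φ p e)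
  ... | false = inj₂ (anyLeaf-false⁻¹ φ p e)

  _≐_ : Subset φ → Subset φ → Set
  s ≐ t = ∀ x → s x ≡ t x

  ∅ : Subset φ
  ∅ _ = false

  full : Subset φ
  full _ = true

  join : Subset φ → Subset ψ → Subset (node c φ ψ)
  join s t (left x)  = s x
  join s t (right y) = t y

  leftPart : Subset (node c φ ψ) → Subset φ
  leftPart s x = s (left x)

  rightPart : Subset (node c φ ψ) → Subset ψ
  rightPart s y = s (right y)

  join-parts : ∀ (s : Subset (node c φ ψ)) → join (leftPart s) (rightPart s) ≐ s
  join-parts s (left x)  = refl
  join-parts s (right y) = refl

  someLeaf : ∀ (φ : Formula K) → Leaf φ
  someLeaf (atom k)     = here
  someLeaf (node c φ ψ) = left (someLeaf φ)

  eqLeaf-refl : ∀ (x : Leaf φ) → eqLeaf x x ≡ true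
  eqLeaf-refl here      = refl
  eqLeaf-refl (left x)  = eqLeaf-refl x
  eqLeaf-refl (right y) = eqLeaf-refl y

  eqLeaf⇒≡ : ∀ (x y : Leaf φ) → eqLeaf x y ≡ true → x ≡ y
  eqLeaf⇒≡ here      here      _ = refl
  eqLeaf⇒≡ (left x)  (left y)  p = cong left (eqLeaf⇒≡ x y p)
  eqLeaf⇒≡ (right x) (right y) p = cong right (eqLeaf⇒≡ x y p)

  MeetAtAnd-irrefl : ∀ {x : Leaf φ} → MeetAtAnd x x → ⊥
  MeetAtAnd-irrefl (ll m) = MeetAtAnd-irrefl m
  MeetAtAnd-irrefl (rr m) = MeetAtAnd-irrefl m

  singleton-independent : ∀ (x : Leaf φ) → Independent (eqLeaf x)
  singleton-independent x y z xy xz m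
    rewrite eqLeaf⇒≡ x y xy | eqLeaf⇒≡ y z xz = MeetAtAnd-irrefl m

  IsResolution-resp : ∀ {s t : Subset φ} → s ≐ t → IsResolution φ s → IsResolution φ t
  IsResolution-resp s≐t (ind , max) =
    (λ x y tx ty → ind x y (trans (s≐t x) tx) (trans (s≐t y) ty)) ,
    (λ s' t⊆s' ind' x s'x →
       trans (sym (s≐t x)) (max s' (λ z sz → t⊆s' z (trans (sym (s≐t z)) sz)) ind' x s'x))

  InPerp-resp : ∀ {s t : Subset φ} → s ≐ t → InPerp φ s → InPerp φ t
  InPerp-resp s≐t perp r isRes with perp r isRes
  ... | x , sx , rx , unique = x , trans (sym (s≐t x)) sx , rx , λ y ty → unique y (trans (s≐t y) ty)

  -- An empty s lies below the independent singleton {x}, so maximality puts x in s.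
  resolution-nonempty : ∀ {s : Subset φ} → IsResolution φ s → ∃ λ x → s x ≡ true
  resolution-nonempty {φ = φ} {s} (_ , max) with anyLeaf? φ s
  ... | inj₁ witness = witness
  ... | inj₂ empty   = x , max (eqLeaf x) (λ z sz → ⊥-elim (true-false-absurd sz (empty z)))
                                (singleton-independent x) x (eqLeaf-refl x)
    where x = someLeaf φ

  atom-resolution : ∀ {k : K} {s : Subset (atom k)} → s here ≡ true → IsResolution (atom k) s
  atom-resolution s-here = (λ { here here _ _ () }) , (λ { _ _ _ here _ → s-here })

  atom-resolution⁻¹ : ∀ {k : K} {s : Subset (atom k)} → IsResolution (atom k) s → s here ≡ true
  atom-resolution⁻¹ (_ , max) = max full (λ _ _ → refl) (λ { here here _ _ () }) here refl

  ∨-resolution : ∀ {s : Subset φ} {t : Subset ψ} → IsResolution φ s → IsResolution ψ t →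
                 IsResolution (node ∨c φ ψ) (join s t)
  ∨-resolution {φ = φ} {ψ} {s} {t} (ind₁ , max₁) (ind₂ , max₂) = ind , max
    where
    ind : Independent {φ = node ∨c φ ψ} (join s t)
    ind (left x)  (left y)  sx sy (ll m) = ind₁ x y sx sy m
    ind (right x) (right y) tx ty (rr m) = ind₂ x y tx ty m
    max : ∀ s' → join s t ⊆ s' → Independent s' → s' ⊆ join s t
    max s' sub ind' (left x) =
      max₁ (leftPart s') (λ z → sub (left z)) (λ a b pa pb m → ind' _ _ pa pb (ll m)) x
    max s' sub ind' (right y) =
      max₂ (rightPart s') (λ z → sub (right z)) (λ a b pa pb m → ind' _ _ pa pb (rr m)) y

  ∨-resolution⁻¹ : ∀ {s : Subset (node ∨c φ ψ)} → IsResolution (node ∨c φ ψ) s →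
                   IsResolution φ (leftPart s) × IsResolution ψ (rightPart s)
  ∨-resolution⁻¹ {φ = φ} {ψ} {s} (ind , max) =
    ((λ x y p q m → ind _ _ p q (ll m)) ,
     (λ s' sub ind' x → max (join s' (rightPart s)) (λ { (left z) → sub z ; (right z) q → q })
        (λ { (left a) (left b) pa pb (ll m) → ind' a b pa pb m
           ; (right a) (right b) pa pb (rr m) → ind _ _ pa pb (rr m) }) (left x))) ,
    ((λ x y p q m → ind _ _ p q (rr m)) ,
     (λ s' sub ind' y → max (join (leftPart s) s') (λ { (left z) q → q ; (right z) → sub z })
        (λ { (left a) (left b) pa pb (ll m) → ind _ _ pa pb (ll m)
           ; (right a) (right b) pa pb (rr m) → ind' a b pa pb m }) (right y)))

  ∧-resolutionˡ : ∀ {s : Subset φ} → IsResolution φ s → IsResolution (node ∧c φ ψ) (join s ∅)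
  ∧-resolutionˡ {φ = φ} {ψ = ψ} {s} res@(ind₁ , max₁) = ind , max
    where
    ind : Independent {φ = node ∧c φ ψ} (join s ∅)
    ind (left x) (left y) sx sy (ll m) = ind₁ x y sx sy m
    ind (left x) (right y) _ ()
    ind (right x) _ ()
    max : ∀ s' → join s ∅ ⊆ s' → Independent s' → s' ⊆ join s ∅
    max s' sub ind' (left x) =
      max₁ (leftPart s') (λ z → sub (left z)) (λ a b pa pb m → ind' _ _ pa pb (ll m)) x
    max s' sub ind' (right y) s'y =
      let (x , sx) = resolution-nonempty res in ⊥-elim (ind' (left x) (right y) (sub (left x) sx) s'y lr)

  ∧-resolutionʳ : ∀ {s : Subset ψ} → IsResolution ψ s → IsResolution (node ∧c φ ψ) (join ∅ s)
  ∧-resolutionʳ {ψ = ψ} {φ = φ} {s} res@(ind₂ , max₂) = ind , max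
    where
    ind : Independent {φ = node ∧c φ ψ} (join ∅ s)
    ind (right x) (right y) sx sy (rr m) = ind₂ x y sx sy m
    ind (right x) (left y) _ ()
    ind (left x) _ ()
    max : ∀ s' → join ∅ s ⊆ s' → Independent s' → s' ⊆ join ∅ s
    max s' sub ind' (right y) =
      max₂ (rightPart s') (λ z → sub (right z)) (λ a b pa pb m → ind' _ _ pa pb (rr m)) y
    max s' sub ind' (left x) s'x =
      let (y , sy) = resolution-nonempty res in ⊥-elim (ind' (left x) (right y) s'x (sub (right y) sy) lr)

  ∧-resolution⁻¹ : ∀ {s : Subset (node ∧c φ ψ)} → IsResolution (node ∧c φ ψ) s →
                   (IsResolution φ (leftPart s) × IsEmpty (rightPart s)) ⊎
                   (IsEmpty (leftPart s) × IsResolution ψ (rightPart s))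
  ∧-resolution⁻¹ {φ = φ} {ψ} {s} (ind , max) with anyLeaf? φ (leftPart s)
  ... | inj₁ (x₀ , sx₀) = inj₁ (leftResolution , rightEmpty)
    where
    rightEmpty : IsEmpty (rightPart s)
    rightEmpty y = ≢true⇒≡false λ sy → ind (left x₀) (right y) sx₀ sy lr
    leftResolution : IsResolution φ (leftPart s)
    leftResolution =
      (λ x y p q m → ind _ _ p q (ll m)) ,
      (λ s' sub ind' x → max (join s' ∅)
         (λ { (left z) → sub z ; (right z) q → ⊥-elim (true-false-absurd q (rightEmpty z)) })
         (λ { (left a) (left b) pa pb (ll m) → ind' a b pa pb m
            ; (left a) (right b) _ () ; (right a) _ () }) (left x))
  ... | inj₂ leftEmpty = inj₂ (leftEmpty , rightResolution)
    where
    rightResolution : IsResolution ψ (rightPart s)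
    rightResolution =
      (λ x y p q m → ind _ _ p q (rr m)) ,
      (λ s' sub ind' y → max (join ∅ s')
         (λ { (right z) → sub z ; (left z) q → ⊥-elim (true-false-absurd q (leftEmpty z)) })
         (λ { (right a) (right b) pa pb (rr m) → ind' a b pa pb m
            ; (right a) (left b) _ () ; (left a) _ () }) (right y))

  leftmostResolution : ∀ (φ : Formula K) → Subset φ
  leftmostResolution (atom k)      = full
  leftmostResolution (node ∧c φ ψ) = join (leftmostResolution φ) ∅
  leftmostResolution (node ∨c φ ψ) = join (leftmostResolution φ) (leftmostResolution ψ)

  leftmostResolution-isResolution : ∀ (φ : Formula K) → IsResolution φ (leftmostResolution φ)
  leftmostResolution-isResolution (atom k)      = atom-resolution refl
  leftmostResolution-isResolution (node ∧c φ ψ) = ∧-resolutionˡ (leftmostResolution-isResolution φ)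
  leftmostResolution-isResolution (node ∨c φ ψ) =
    ∨-resolution (leftmostResolution-isResolution φ) (leftmostResolution-isResolution ψ)

  resolutionThrough : ∀ (x : Leaf φ) → ∃ λ s → IsResolution φ s × s x ≡ true
  resolutionThrough {φ = atom k} here = full , atom-resolution refl , refl
  resolutionThrough {φ = node ∧c φ ψ} (left x) =
    let (s , res , sx) = resolutionThrough x in join s ∅ , ∧-resolutionˡ res , sx
  resolutionThrough {φ = node ∧c φ ψ} (right y) =
    let (s , res , sy) = resolutionThrough y in join ∅ s , ∧-resolutionʳ res , sy
  resolutionThrough {φ = node ∨c φ ψ} (left x) =
    let (s , res , sx) = resolutionThrough x
    in join s (leftmostResolution ψ) , ∨-resolution res (leftmostResolution-isResolution ψ) , sx
  resolutionThrough {φ = node ∨c φ ψ} (right y) =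
    let (s , res , sy) = resolutionThrough y
    in join (leftmostResolution φ) s , ∨-resolution (leftmostResolution-isResolution φ) res , sy

  Disjoint : Subset φ → Subset φ → Set
  Disjoint s t = ∀ x → s x ≡ true → t x ≡ true → ⊥

  emptyˡ-disjoint : ∀ {s t : Subset φ} → IsEmpty s → Disjoint s t
  emptyˡ-disjoint s-empty x sx _ = true-false-absurd sx (s-empty x)

  emptyʳ-disjoint : ∀ {s t : Subset φ} → IsEmpty t → Disjoint s t
  emptyʳ-disjoint t-empty x _ tx = true-false-absurd tx (t-empty x)

  left-injective : ∀ {x y : Leaf φ} → left {c = c} {ψ = ψ} x ≡ left y → x ≡ y
  left-injective refl = refl

  right-injective : ∀ {x y : Leaf ψ} → right {c = c} {φ = φ} x ≡ right y → x ≡ y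
  right-injective refl = refl

  module _ {α σ : Subset (node c φ ψ)} where

    ⊥ˢ-leftPart : α ⊥ˢ σ → Disjoint (rightPart α) (rightPart σ) → leftPart α ⊥ˢ leftPart σ
    ⊥ˢ-leftPart (left x , αx , σx , unique) _ =
      x , αx , σx , λ y αy σy → left-injective (unique (left y) αy σy)
    ⊥ˢ-leftPart (right y , αy , σy , _) disjoint = ⊥-elim (disjoint y αy σy)

    ⊥ˢ-rightPart : α ⊥ˢ σ → Disjoint (leftPart α) (leftPart σ) → rightPart α ⊥ˢ rightPart σ
    ⊥ˢ-rightPart (right y , αy , σy , unique) _ =
      y , αy , σy , λ z αz σz → right-injective (unique (right z) αz σz)
    ⊥ˢ-rightPart (left x , αx , σx , _) disjoint = ⊥-elim (disjoint x αx σx)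

    ⊥ˢ-fromLeftPart : leftPart α ⊥ˢ leftPart σ → Disjoint (rightPart α) (rightPart σ) → α ⊥ˢ σ
    ⊥ˢ-fromLeftPart (x , αx , σx , unique) disjoint = left x , αx , σx , λ
      { (left y)  αy σy → cong left (unique y αy σy)
      ; (right y) αy σy → ⊥-elim (disjoint y αy σy) }

    ⊥ˢ-fromRightPart : rightPart α ⊥ˢ rightPart σ → Disjoint (leftPart α) (leftPart σ) → α ⊥ˢ σ
    ⊥ˢ-fromRightPart (y , αy , σy , unique) disjoint = right y , αy , σy , λ
      { (right z) αz σz → cong right (unique z αz σz)
      ; (left x)  αx σx → ⊥-elim (disjoint x αx σx) }

  atom-perp : ∀ {k : K} {α : Subset (atom k)} → α here ≡ true → InPerp (atom k) α
  atom-perp α-here s res = here , α-here , atom-resolution⁻¹ res , λ { here _ _ → refl }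

  atom-perp⁻¹ : ∀ {k : K} {α : Subset (atom k)} → InPerp (atom k) α → α here ≡ true
  atom-perp⁻¹ perp with perp full (atom-resolution refl)
  ... | here , α-here , _ = α-here

  ∧-perp : ∀ {α : Subset (node ∧c φ ψ)} → InPerp φ (leftPart α) → InPerp ψ (rightPart α) →
           InPerp (node ∧c φ ψ) α
  ∧-perp perpˡ perpʳ s res with ∧-resolution⁻¹ res
  ... | inj₁ (resˡ , emptyʳ) = ⊥ˢ-fromLeftPart (perpˡ _ resˡ) (emptyʳ-disjoint emptyʳ)
  ... | inj₂ (emptyˡ , resʳ) = ⊥ˢ-fromRightPart (perpʳ _ resʳ) (emptyʳ-disjoint emptyˡ)

  ∧-perp⁻¹ : ∀ {α : Subset (node ∧c φ ψ)} → InPerp (node ∧c φ ψ) α →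
             InPerp φ (leftPart α) × InPerp ψ (rightPart α)
  ∧-perp⁻¹ perp =
    (λ s res → ⊥ˢ-leftPart (perp (join s ∅) (∧-resolutionˡ res)) λ _ _ ()) ,
    (λ s res → ⊥ˢ-rightPart (perp (join ∅ s) (∧-resolutionʳ res)) λ _ _ ())

  ∨-perpˡ : ∀ {α : Subset (node ∨c φ ψ)} → InPerp φ (leftPart α) → IsEmpty (rightPart α) →
            InPerp (node ∨c φ ψ) α
  ∨-perpˡ perpˡ emptyʳ s res =
    ⊥ˢ-fromLeftPart (perpˡ _ (proj₁ (∨-resolution⁻¹ res))) (emptyˡ-disjoint emptyʳ)

  ∨-perpʳ : ∀ {α : Subset (node ∨c φ ψ)} → IsEmpty (leftPart α) → InPerp ψ (rightPart α) →
            InPerp (node ∨c φ ψ) α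
  ∨-perpʳ emptyˡ perpʳ s res =
    ⊥ˢ-fromRightPart (perpʳ _ (proj₂ (∨-resolution⁻¹ res))) (emptyˡ-disjoint emptyˡ)

  ∨-perp-oneSided : ∀ {α : Subset (node ∨c φ ψ)} → InPerp (node ∨c φ ψ) α →
                    ∀ x y → α (left x) ≡ true → α (right y) ≡ true → ⊥
  ∨-perp-oneSided perp x y αx αy with resolutionThrough x | resolutionThrough y
  ... | s , resˡ , sx | t , resʳ , ty with perp (join s t) (∨-resolution resˡ resʳ)
  ... | _ , _ , _ , unique with trans (unique (left x) αx sx) (sym (unique (right y) αy ty))
  ... | ()

  ∨-perp⁻¹ : ∀ {α : Subset (node ∨c φ ψ)} → InPerp (node ∨c φ ψ) α →
             (InPerp φ (leftPart α) × IsEmpty (rightPart α)) ⊎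
             (IsEmpty (leftPart α) × InPerp ψ (rightPart α))
  ∨-perp⁻¹ {φ = φ} {ψ} {α} perp with anyLeaf? φ (leftPart α)
  ... | inj₁ (x , αx) = inj₁ (perpˡ , emptyʳ)
    where
    emptyʳ : IsEmpty (rightPart α)
    emptyʳ y = ≢true⇒≡false (∨-perp-oneSided perp x y αx)
    perpˡ : InPerp φ (leftPart α)
    perpˡ s res = ⊥ˢ-leftPart (perp _ (∨-resolution res (leftmostResolution-isResolution ψ)))
                              (emptyˡ-disjoint emptyʳ)
  ... | inj₂ emptyˡ = inj₂ (emptyˡ , perpʳ)
    where
    perpʳ : InPerp ψ (rightPart α)
    perpʳ t res = ⊥ˢ-rightPart (perp _ (∨-resolution (leftmostResolution-isResolution φ) res))
                               (emptyˡ-disjoint emptyˡ)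

  leftmostPerp : ∀ (φ : Formula K) → Subset φ
  leftmostPerp (atom k)      = full
  leftmostPerp (node ∧c φ ψ) = join (leftmostPerp φ) (leftmostPerp ψ)
  leftmostPerp (node ∨c φ ψ) = join (leftmostPerp φ) ∅

  leftmostPerp-isPerp : ∀ (φ : Formula K) → InPerp φ (leftmostPerp φ)
  leftmostPerp-isPerp (atom k)      = atom-perp refl
  leftmostPerp-isPerp (node ∧c φ ψ) = ∧-perp (leftmostPerp-isPerp φ) (leftmostPerp-isPerp ψ)
  leftmostPerp-isPerp (node ∨c φ ψ) = ∨-perpˡ (leftmostPerp-isPerp φ) (λ _ → refl)

  perp-nonempty : ∀ {α : Subset φ} → InPerp φ α → ∃ λ x → α x ≡ true
  perp-nonempty {φ = φ} perp =
    let (x , αx , _) = perp (leftmostResolution φ) (leftmostResolution-isResolution φ) in x , αx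

  -- The resolution condition

  ∨-falseˡ : ∀ {a b} → a ≡ false → a ∨ b ≡ b
  ∨-falseˡ refl = refl

  ∨-falseʳ : ∀ {a b} → b ≡ false → a ∨ b ≡ a
  ∨-falseʳ {a} refl = ∨-identityʳ a

  anyLeaf-∧-emptyˡ : ∀ (φ : Formula K) {p : Leaf φ → Bool} (q : Leaf φ → Bool) → IsEmpty p →
                     anyLeaf φ (λ x → p x ∧ q x) ≡ false
  anyLeaf-∧-emptyˡ φ q p-empty = anyLeaf-false φ _ λ x → cong (_∧ q x) (p-empty x)

  anyLeaf-∧-emptyʳ : ∀ (φ : Formula K) (p : Leaf φ → Bool) {q : Leaf φ → Bool} → IsEmpty q →
                     anyLeaf φ (λ x → p x ∧ q x) ≡ false
  anyLeaf-∧-emptyʳ φ p q-empty =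
    anyLeaf-false φ _ λ x → trans (cong (p x ∧_) (q-empty x)) (∧-zeroʳ (p x))

  preimage′ : Rel φ ψ → Subset ψ → Subset φ
  preimage′ {ψ = ψ} R t x = anyLeaf ψ (λ y → t y ∧ R x y)

  image′ : Rel φ ψ → Subset φ → Subset ψ
  image′ {φ = φ} R α y = anyLeaf φ (λ x → α x ∧ R x y)

  ResolutionCondition′ : Rel φ ψ → Set
  ResolutionCondition′ {φ = φ} {ψ = ψ} R =
    (∀ t → IsResolution ψ t → IsResolution φ (preimage′ R t)) ×
    (∀ α → InPerp φ α → InPerp ψ (image′ R α))

  ResolutionCondition′⇒ResolutionCondition : ∀ {R : Rel φ ψ} →
    ResolutionCondition′ R → ResolutionCondition R
  ResolutionCondition′⇒ResolutionCondition {φ = φ} {ψ = ψ} (pre , img) =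
    (λ t res → IsResolution-resp (λ x → sym (any-allLeaves ψ _)) (pre t res)) ,
    (λ α perp → InPerp-resp (λ y → sym (any-allLeaves φ _)) (img α perp))

  ResolutionCondition⇒ResolutionCondition′ : ∀ {R : Rel φ ψ} →
    ResolutionCondition R → ResolutionCondition′ R
  ResolutionCondition⇒ResolutionCondition′ {φ = φ} {ψ = ψ} (pre , img) =
    (λ t res → IsResolution-resp (λ x → any-allLeaves ψ _) (pre t res)) ,
    (λ α perp → InPerp-resp (λ y → any-allLeaves φ _) (img α perp))

  ResolutionCondition′-resp : ∀ {R R' : Rel φ ψ} → R ≈R R' →
    ResolutionCondition′ R → ResolutionCondition′ R'
  ResolutionCondition′-resp {φ = φ} {ψ = ψ} R≈R' (pre , img) =
    (λ t res → IsResolution-resp (λ x → anyLeaf-cong ψ λ y → cong (t y ∧_) (R≈R' x y)) (pre t res)) ,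
    (λ α perp → InPerp-resp (λ y → anyLeaf-cong φ λ x → cong (α x ∧_) (R≈R' x y)) (img α perp))

  emptyRel : Rel φ ψ
  emptyRel _ _ = false

  joinSource : Rel φ₁ ψ → Rel φ₂ ψ → Rel (node c φ₁ φ₂) ψ
  joinSource R₁ R₂ (left x)  y = R₁ x y
  joinSource R₁ R₂ (right x) y = R₂ x y

  joinTarget : Rel φ ψ₁ → Rel φ ψ₂ → Rel φ (node c ψ₁ ψ₂)
  joinTarget R₁ R₂ x (left y)  = R₁ x y
  joinTarget R₁ R₂ x (right y) = R₂ x y

  sourceˡ : Rel (node c φ₁ φ₂) ψ → Rel φ₁ ψ
  sourceˡ R x y = R (left x) y

  sourceʳ : Rel (node c φ₁ φ₂) ψ → Rel φ₂ ψ
  sourceʳ R x y = R (right x) y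

  targetˡ : Rel φ (node c ψ₁ ψ₂) → Rel φ ψ₁
  targetˡ R x y = R x (left y)

  targetʳ : Rel φ (node c ψ₁ ψ₂) → Rel φ ψ₂
  targetʳ R x y = R x (right y)

  IsEmptyRel : Rel φ ψ → Set
  IsEmptyRel R = ∀ x y → R x y ≡ false

  module _ {R₁ : Rel φ ψ₁} {R₂ : Rel φ ψ₂} where

    resCond-∧-joinTarget : ResolutionCondition′ R₁ → ResolutionCondition′ R₂ →
                           ResolutionCondition′ (joinTarget {c = ∧c} R₁ R₂)
    resCond-∧-joinTarget (pre₁ , img₁) (pre₂ , img₂) = pre , λ α perp → ∧-perp (img₁ α perp) (img₂ α perp)
      where
      pre : ∀ t → IsResolution (node ∧c ψ₁ ψ₂) t → IsResolution φ (preimage′ (joinTarget R₁ R₂) t)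
      pre t res with ∧-resolution⁻¹ res
      ... | inj₁ (resˡ , emptyʳ) =
        IsResolution-resp (λ x → sym (∨-falseʳ (anyLeaf-∧-emptyˡ ψ₂ _ emptyʳ))) (pre₁ _ resˡ)
      ... | inj₂ (emptyˡ , resʳ) =
        IsResolution-resp (λ x → sym (∨-falseˡ (anyLeaf-∧-emptyˡ ψ₁ _ emptyˡ))) (pre₂ _ resʳ)

  module _ {R₁ : Rel φ₁ ψ} {R₂ : Rel φ₂ ψ} where

    resCond-∨-joinSource : ResolutionCondition′ R₁ → ResolutionCondition′ R₂ →
                           ResolutionCondition′ (joinSource {c = ∨c} R₁ R₂)
    resCond-∨-joinSource (pre₁ , img₁) (pre₂ , img₂) =
      (λ t res → IsResolution-resp (join-parts _) (∨-resolution (pre₁ t res) (pre₂ t res))) , img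
      where
      img : ∀ α → InPerp (node ∨c φ₁ φ₂) α → InPerp ψ (image′ (joinSource R₁ R₂) α)
      img α perp with ∨-perp⁻¹ perp
      ... | inj₁ (perpˡ , emptyʳ) =
        InPerp-resp (λ y → sym (∨-falseʳ (anyLeaf-∧-emptyˡ φ₂ _ emptyʳ))) (img₁ _ perpˡ)
      ... | inj₂ (emptyˡ , perpʳ) =
        InPerp-resp (λ y → sym (∨-falseˡ (anyLeaf-∧-emptyˡ φ₁ _ emptyˡ))) (img₂ _ perpʳ)

  resCond-∧-extendˡ : ∀ {R : Rel φ₁ ψ} → ResolutionCondition′ R →
                      ResolutionCondition′ (joinSource {c = ∧c} R (emptyRel {φ = φ₂}))
  resCond-∧-extendˡ {ψ = ψ} {φ₂ = φ₂} (pre , img) =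
    (λ t res → IsResolution-resp
       (λ { (left x) → refl ; (right x) → sym (anyLeaf-∧-emptyʳ ψ t λ _ → refl) })
       (∧-resolutionˡ (pre t res))) ,
    (λ α perp → InPerp-resp (λ y → sym (∨-falseʳ (anyLeaf-∧-emptyʳ φ₂ _ λ _ → refl)))
       (img _ (proj₁ (∧-perp⁻¹ perp))))

  resCond-∧-extendʳ : ∀ {R : Rel φ₂ ψ} → ResolutionCondition′ R →
                      ResolutionCondition′ (joinSource {c = ∧c} (emptyRel {φ = φ₁}) R)
  resCond-∧-extendʳ {ψ = ψ} {φ₁ = φ₁} (pre , img) =
    (λ t res → IsResolution-resp
       (λ { (right x) → refl ; (left x) → sym (anyLeaf-∧-emptyʳ ψ t λ _ → refl) })
       (∧-resolutionʳ (pre t res))) ,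
    (λ α perp → InPerp-resp (λ y → sym (∨-falseˡ (anyLeaf-∧-emptyʳ φ₁ _ λ _ → refl)))
       (img _ (proj₂ (∧-perp⁻¹ perp))))

  resCond-∨-extendˡ : ∀ {R : Rel φ ψ₁} → ResolutionCondition′ R →
                      ResolutionCondition′ (joinTarget {c = ∨c} R (emptyRel {ψ = ψ₂}))
  resCond-∨-extendˡ {φ = φ} {ψ₂ = ψ₂} (pre , img) =
    (λ t res → IsResolution-resp (λ x → sym (∨-falseʳ (anyLeaf-∧-emptyʳ ψ₂ _ λ _ → refl)))
       (pre _ (proj₁ (∨-resolution⁻¹ res)))) ,
    (λ α perp → ∨-perpˡ (img α perp) λ y → anyLeaf-∧-emptyʳ φ α λ _ → refl)

  resCond-∨-extendʳ : ∀ {R : Rel φ ψ₂} → ResolutionCondition′ R →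
                      ResolutionCondition′ (joinTarget {c = ∨c} (emptyRel {ψ = ψ₁}) R)
  resCond-∨-extendʳ {φ = φ} {ψ₁ = ψ₁} (pre , img) =
    (λ t res → IsResolution-resp (λ x → sym (∨-falseˡ (anyLeaf-∧-emptyʳ ψ₁ _ λ _ → refl)))
       (pre _ (proj₂ (∨-resolution⁻¹ res)))) ,
    (λ α perp → ∨-perpʳ (λ y → anyLeaf-∧-emptyʳ φ α λ _ → refl) (img α perp))

  resCond-∧-targetˡ : ∀ {R : Rel φ (node ∧c ψ₁ ψ₂)} →
                      ResolutionCondition′ R → ResolutionCondition′ (targetˡ R)
  resCond-∧-targetˡ {ψ₂ = ψ₂} (pre , img) =
    (λ t res → IsResolution-resp (λ x → ∨-falseʳ (anyLeaf-false ψ₂ _ λ _ → refl))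
       (pre (join t ∅) (∧-resolutionˡ res))) ,
    (λ α perp → proj₁ (∧-perp⁻¹ (img α perp)))

  resCond-∧-targetʳ : ∀ {R : Rel φ (node ∧c ψ₁ ψ₂)} →
                      ResolutionCondition′ R → ResolutionCondition′ (targetʳ R)
  resCond-∧-targetʳ {ψ₁ = ψ₁} (pre , img) =
    (λ t res → IsResolution-resp (λ x → ∨-falseˡ (anyLeaf-false ψ₁ _ λ _ → refl))
       (pre (join ∅ t) (∧-resolutionʳ res))) ,
    (λ α perp → proj₂ (∧-perp⁻¹ (img α perp)))

  resCond-∨-sourceˡ : ∀ {R : Rel (node ∨c φ₁ φ₂) ψ} →
                      ResolutionCondition′ R → ResolutionCondition′ (sourceˡ R)
  resCond-∨-sourceˡ {φ₂ = φ₂} (pre , img) =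
    (λ t res → proj₁ (∨-resolution⁻¹ (pre t res))) ,
    (λ α perp → InPerp-resp (λ y → ∨-falseʳ (anyLeaf-false φ₂ _ λ _ → refl))
       (img (join α ∅) (∨-perpˡ perp λ _ → refl)))

  resCond-∨-sourceʳ : ∀ {R : Rel (node ∨c φ₁ φ₂) ψ} →
                      ResolutionCondition′ R → ResolutionCondition′ (sourceʳ R)
  resCond-∨-sourceʳ {φ₁ = φ₁} (pre , img) =
    (λ t res → proj₂ (∨-resolution⁻¹ (pre t res))) ,
    (λ α perp → InPerp-resp (λ y → ∨-falseˡ (anyLeaf-false φ₁ _ λ _ → refl))
       (img (join ∅ α) (∨-perpʳ (λ _ → refl) perp)))

  resCond-∧-sourceˡ : ∀ {R : Rel (node ∧c φ₁ φ₂) ψ} → ResolutionCondition′ R →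
                      IsEmptyRel (sourceʳ R) → ResolutionCondition′ (sourceˡ R)
  resCond-∧-sourceˡ {φ₁ = φ₁} {φ₂} {ψ} {R} (pre , img) emptyʳ = pre′ , img′
    where
    pre′ : ∀ t → IsResolution ψ t → IsResolution φ₁ (preimage′ (sourceˡ R) t)
    pre′ t res with ∧-resolution⁻¹ (pre t res)
    ... | inj₁ (resˡ , _) = resˡ
    ... | inj₂ (_ , resʳ) = let (x , tx) = resolution-nonempty resʳ in
      ⊥-elim (true-false-absurd tx (anyLeaf-∧-emptyʳ ψ t (emptyʳ x)))
    img′ : ∀ α → InPerp φ₁ α → InPerp ψ (image′ (sourceˡ R) α)
    img′ α perp = InPerp-resp (λ y → ∨-falseʳ (anyLeaf-∧-emptyʳ φ₂ _ λ x → emptyʳ x y))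
      (img (join α (leftmostPerp φ₂)) (∧-perp perp (leftmostPerp-isPerp φ₂)))

  resCond-∧-sourceʳ : ∀ {R : Rel (node ∧c φ₁ φ₂) ψ} → ResolutionCondition′ R →
                      IsEmptyRel (sourceˡ R) → ResolutionCondition′ (sourceʳ R)
  resCond-∧-sourceʳ {φ₁ = φ₁} {φ₂} {ψ} {R} (pre , img) emptyˡ = pre′ , img′
    where
    pre′ : ∀ t → IsResolution ψ t → IsResolution φ₂ (preimage′ (sourceʳ R) t)
    pre′ t res with ∧-resolution⁻¹ (pre t res)
    ... | inj₂ (_ , resʳ) = resʳ
    ... | inj₁ (resˡ , _) = let (x , tx) = resolution-nonempty resˡ in
      ⊥-elim (true-false-absurd tx (anyLeaf-∧-emptyʳ ψ t (emptyˡ x)))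
    img′ : ∀ α → InPerp φ₂ α → InPerp ψ (image′ (sourceʳ R) α)
    img′ α perp = InPerp-resp (λ y → ∨-falseˡ (anyLeaf-∧-emptyʳ φ₁ _ λ x → emptyˡ x y))
      (img (join (leftmostPerp φ₁) α) (∧-perp (leftmostPerp-isPerp φ₁) perp))

  resCond-∨-targetˡ : ∀ {R : Rel φ (node ∨c ψ₁ ψ₂)} → ResolutionCondition′ R →
                      IsEmptyRel (targetʳ R) → ResolutionCondition′ (targetˡ R)
  resCond-∨-targetˡ {φ = φ} {ψ₁} {ψ₂} {R} (pre , img) emptyʳ = pre′ , img′
    where
    pre′ : ∀ t → IsResolution ψ₁ t → IsResolution φ (preimage′ (targetˡ R) t)
    pre′ t res = IsResolution-resp (λ x → ∨-falseʳ (anyLeaf-∧-emptyʳ ψ₂ _ (emptyʳ x)))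
      (pre (join t (leftmostResolution ψ₂)) (∨-resolution res (leftmostResolution-isResolution ψ₂)))
    img′ : ∀ α → InPerp φ α → InPerp ψ₁ (image′ (targetˡ R) α)
    img′ α perp with ∨-perp⁻¹ (img α perp)
    ... | inj₁ (perpˡ , _) = perpˡ
    ... | inj₂ (_ , perpʳ) = let (y , αy) = perp-nonempty perpʳ in
      ⊥-elim (true-false-absurd αy (anyLeaf-∧-emptyʳ φ α λ x → emptyʳ x y))

  resCond-∨-targetʳ : ∀ {R : Rel φ (node ∨c ψ₁ ψ₂)} → ResolutionCondition′ R →
                      IsEmptyRel (targetˡ R) → ResolutionCondition′ (targetʳ R)
  resCond-∨-targetʳ {φ = φ} {ψ₁} {ψ₂} {R} (pre , img) emptyˡ = pre′ , img′
    where
    pre′ : ∀ t → IsResolution ψ₂ t → IsResolution φ (preimage′ (targetʳ R) t)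
    pre′ t res = IsResolution-resp (λ x → ∨-falseˡ (anyLeaf-∧-emptyʳ ψ₁ _ (emptyˡ x)))
      (pre (join (leftmostResolution ψ₁) t) (∨-resolution (leftmostResolution-isResolution ψ₁) res))
    img′ : ∀ α → InPerp φ α → InPerp ψ₂ (image′ (targetʳ R) α)
    img′ α perp with ∨-perp⁻¹ (img α perp)
    ... | inj₂ (_ , perpʳ) = perpʳ
    ... | inj₁ (perpˡ , _) = let (y , αy) = perp-nonempty perpˡ in
      ⊥-elim (true-false-absurd αy (anyLeaf-∧-emptyʳ φ α λ x → emptyˡ x y))

  -- Cut-free derivations

  infix 4 _⊢_

  data _⊢_ : Formula K → Formula K → Set where
    ax  : ∀ {k} → atom k ⊢ atom k
    ∧R  : ∀ {φ ψ₁ ψ₂} → φ ⊢ ψ₁ → φ ⊢ ψ₂ → φ ⊢ node ∧c ψ₁ ψ₂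
    ∨L  : ∀ {φ₁ φ₂ ψ} → φ₁ ⊢ ψ → φ₂ ⊢ ψ → node ∨c φ₁ φ₂ ⊢ ψ
    ∧L₁ : ∀ {φ₁ φ₂ ψ} → φ₁ ⊢ ψ → node ∧c φ₁ φ₂ ⊢ ψ
    ∧L₂ : ∀ {φ₁ φ₂ ψ} → φ₂ ⊢ ψ → node ∧c φ₁ φ₂ ⊢ ψ
    ∨R₁ : ∀ {φ ψ₁ ψ₂} → φ ⊢ ψ₁ → φ ⊢ node ∨c ψ₁ ψ₂
    ∨R₂ : ∀ {φ ψ₁ ψ₂} → φ ⊢ ψ₂ → φ ⊢ node ∨c ψ₁ ψ₂

  linking : φ ⊢ ψ → Rel φ ψ
  linking ax       = λ _ _ → true
  linking (∧R d e) = joinTarget (linking d) (linking e)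
  linking (∨L d e) = joinSource (linking d) (linking e)
  linking (∧L₁ d)  = joinSource (linking d) emptyRel
  linking (∧L₂ d)  = joinSource emptyRel (linking d)
  linking (∨R₁ d)  = joinTarget (linking d) emptyRel
  linking (∨R₂ d)  = joinTarget emptyRel (linking d)

  linking-resCond : ∀ (d : φ ⊢ ψ) → ResolutionCondition′ (linking d)
  linking-resCond ax       = (λ t res → atom-resolution (cong (_∧ true) (atom-resolution⁻¹ res))) ,
                             (λ α perp → atom-perp (cong (_∧ true) (atom-perp⁻¹ perp)))
  linking-resCond (∧R d e) = resCond-∧-joinTarget (linking-resCond d) (linking-resCond e)
  linking-resCond (∨L d e) = resCond-∨-joinSource (linking-resCond d) (linking-resCond e)
  linking-resCond (∧L₁ d)  = resCond-∧-extendˡ (linking-resCond d)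
  linking-resCond (∧L₂ d)  = resCond-∧-extendʳ (linking-resCond d)
  linking-resCond (∨R₁ d)  = resCond-∨-extendˡ (linking-resCond d)
  linking-resCond (∨R₂ d)  = resCond-∨-extendʳ (linking-resCond d)

  linking-respectsLabels : ∀ (d : φ ⊢ ψ) → RespectsLabels (linking d)
  linking-respectsLabels ax       here      here      _ = refl
  linking-respectsLabels (∧R d e) x         (left y)  p = linking-respectsLabels d x y p
  linking-respectsLabels (∧R d e) x         (right y) p = linking-respectsLabels e x y p
  linking-respectsLabels (∨L d e) (left x)  y         p = linking-respectsLabels d x y p
  linking-respectsLabels (∨L d e) (right x) y         p = linking-respectsLabels e x y p
  linking-respectsLabels (∧L₁ d)  (left x)  y         p = linking-respectsLabels d x y p
  linking-respectsLabels (∧L₂ d)  (right x) y         p = linking-respectsLabels d x y p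
  linking-respectsLabels (∨R₁ d)  x         (left y)  p = linking-respectsLabels d x y p
  linking-respectsLabels (∨R₂ d)  x         (right y) p = linking-respectsLabels d x y p

  linking-nonempty : ∀ (d : φ ⊢ ψ) → ∃ λ x → ∃ λ y → linking d x y ≡ true
  linking-nonempty ax       = here , here , refl
  linking-nonempty (∧R d e) = let (x , y , p) = linking-nonempty d in x , left y , p
  linking-nonempty (∨L d e) = let (x , y , p) = linking-nonempty d in left x , y , p
  linking-nonempty (∧L₁ d)  = let (x , y , p) = linking-nonempty d in left x , y , p
  linking-nonempty (∧L₂ d)  = let (x , y , p) = linking-nonempty d in right x , y , p
  linking-nonempty (∨R₁ d)  = let (x , y , p) = linking-nonempty d in x , left y , p
  linking-nonempty (∨R₂ d)  = let (x , y , p) = linking-nonempty d in x , right y , p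

  -- Sequentialisation

  DerivationOf : Rel φ ψ → Set
  DerivationOf {φ = φ} {ψ = ψ} R = Σ (φ ⊢ ψ) λ d → linking d ≈R R

  Sequentialisable : Formula K → Formula K → Set
  Sequentialisable φ ψ =
    ∀ (R : Rel φ ψ) → ResolutionCondition′ R → RespectsLabels R → DerivationOf R

  edge? : ∀ (R : Rel φ ψ) → (∃ λ x → ∃ λ y → R x y ≡ true) ⊎ IsEmptyRel R
  edge? {φ = φ} {ψ = ψ} R with anyLeaf? φ (λ x → anyLeaf ψ (R x))
  ... | inj₁ (x , p) = let (y , q) = anyLeaf-elim ψ (R x) p in inj₁ (x , y , q)
  ... | inj₂ none    = inj₂ λ x → anyLeaf-false⁻¹ ψ (R x) (none x)

  seq-ax : ∀ {k k' : K} → Sequentialisable (atom k) (atom k')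
  seq-ax {k = k} {k'} R rc labels = derivation (labels here here R-here)
    where
    R-here : R here here ≡ true
    R-here = atom-resolution⁻¹ (proj₁ rc full (atom-resolution refl))
    derivation : k ≡ k' → DerivationOf R
    derivation refl = ax , λ { here here → sym R-here }

  seq-∧R : Sequentialisable φ ψ₁ → Sequentialisable φ ψ₂ → Sequentialisable φ (node ∧c ψ₁ ψ₂)
  seq-∧R seq₁ seq₂ R rc labels
    with seq₁ (targetˡ R) (resCond-∧-targetˡ rc) (λ x y → labels x (left y))
       | seq₂ (targetʳ R) (resCond-∧-targetʳ rc) (λ x y → labels x (right y))
  ... | d , d≈ | e , e≈ = ∧R d e , λ { x (left y) → d≈ x y ; x (right y) → e≈ x y }

  seq-∨L : Sequentialisable φ₁ ψ → Sequentialisable φ₂ ψ → Sequentialisable (node ∨c φ₁ φ₂) ψ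
  seq-∨L seq₁ seq₂ R rc labels
    with seq₁ (sourceˡ R) (resCond-∨-sourceˡ rc) (λ x y → labels (left x) y)
       | seq₂ (sourceʳ R) (resCond-∨-sourceʳ rc) (λ x y → labels (right x) y)
  ... | d , d≈ | e , e≈ = ∨L d e , λ { (left x) y → d≈ x y ; (right x) y → e≈ x y }

  module _ (R : Rel (node ∧c φ₁ φ₂) ψ) (rc : ResolutionCondition′ R) (labels : RespectsLabels R) where

    seq-∧L₁ : Sequentialisable φ₁ ψ → IsEmptyRel (sourceʳ R) → DerivationOf R
    seq-∧L₁ seq emptyʳ with seq (sourceˡ R) (resCond-∧-sourceˡ rc emptyʳ) (λ x y → labels (left x) y)
    ... | d , d≈ = ∧L₁ d , λ { (left x) y → d≈ x y ; (right x) y → sym (emptyʳ x y) }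

    seq-∧L₂ : Sequentialisable φ₂ ψ → IsEmptyRel (sourceˡ R) → DerivationOf R
    seq-∧L₂ seq emptyˡ with seq (sourceʳ R) (resCond-∧-sourceʳ rc emptyˡ) (λ x y → labels (right x) y)
    ... | d , d≈ = ∧L₂ d , λ { (right x) y → d≈ x y ; (left x) y → sym (emptyˡ x y) }

  module _ (R : Rel φ (node ∨c ψ₁ ψ₂)) (rc : ResolutionCondition′ R) (labels : RespectsLabels R) where

    seq-∨R₁ : Sequentialisable φ ψ₁ → IsEmptyRel (targetʳ R) → DerivationOf R
    seq-∨R₁ seq emptyʳ with seq (targetˡ R) (resCond-∨-targetˡ rc emptyʳ) (λ x y → labels x (left y))
    ... | d , d≈ = ∨R₁ d , λ { x (left y) → d≈ x y ; x (right y) → sym (emptyʳ x y) }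

    seq-∨R₂ : Sequentialisable φ ψ₂ → IsEmptyRel (targetˡ R) → DerivationOf R
    seq-∨R₂ seq emptyˡ with seq (targetʳ R) (resCond-∨-targetʳ rc emptyˡ) (λ x y → labels x (right y))
    ... | d , d≈ = ∨R₂ d , λ { x (right y) → d≈ x y ; x (left y) → sym (emptyˡ x y) }

  seq-atom-∨ : ∀ {k : K} → Sequentialisable (atom k) ψ₁ → Sequentialisable (atom k) ψ₂ →
               Sequentialisable (atom k) (node ∨c ψ₁ ψ₂)
  seq-atom-∨ seq₁ seq₂ R rc labels with ∨-perp⁻¹ (proj₂ rc full (atom-perp refl))
  ... | inj₁ (_ , emptyʳ) = seq-∨R₁ R rc labels seq₁ λ { here y → emptyʳ y }
  ... | inj₂ (emptyˡ , _) = seq-∨R₂ R rc labels seq₂ λ { here y → emptyˡ y }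

  seq-∧-atom : ∀ {k : K} → Sequentialisable φ₁ (atom k) → Sequentialisable φ₂ (atom k) →
               Sequentialisable (node ∧c φ₁ φ₂) (atom k)
  seq-∧-atom seq₁ seq₂ R rc labels with ∧-resolution⁻¹ (proj₁ rc full (atom-resolution refl))
  ... | inj₁ (_ , emptyʳ) = seq-∧L₁ R rc labels seq₁ λ { x here → emptyʳ x }
  ... | inj₂ (emptyˡ , _) = seq-∧L₂ R rc labels seq₂ λ { x here → emptyˡ x }

  ∨-resolutionThrough : ∀ (x : Leaf ψ₁) (y : Leaf ψ₂) →
    ∃ λ t → IsResolution (node ∨c ψ₁ ψ₂) t × t (left x) ≡ true × t (right y) ≡ true
  ∨-resolutionThrough x y with resolutionThrough x | resolutionThrough y
  ... | s , resˡ , sx | t , resʳ , ty = join s t , ∨-resolution resˡ resʳ , sx , ty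

  isLeft : Leaf (node c φ ψ) → Bool
  isLeft (left _)  = true
  isLeft (right _) = false

  module _ {R : Rel (node ∧c φ₁ φ₂) ψ} (rc : ResolutionCondition′ R) where

    ∧-preimage-oneSided : ∀ {t} → IsResolution ψ t → ∀ {a b c d} → t b ≡ true → t d ≡ true →
                          R (left a) b ≡ true → R (right c) d ≡ true → ⊥
    ∧-preimage-oneSided {t} res {a} {b} {c} {d} tb td ab cd with ∧-resolution⁻¹ (proj₁ rc t res)
    ... | inj₁ (_ , emptyʳ) = true-false-absurd (anyLeaf-∧-intro ψ t (R (right c)) d td cd) (emptyʳ c)
    ... | inj₂ (emptyˡ , _) = true-false-absurd (anyLeaf-∧-intro ψ t (R (left a)) b tb ab) (emptyˡ a)

  -- Any two leaves on opposite sides of the ∨ lie in a common resolution, whose preimage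
  -- would then meet both sides of the ∧.
  ∧-∨-targets-sameSide : ∀ {R : Rel (node ∧c φ₁ φ₂) (node ∨c ψ₁ ψ₂)} → ResolutionCondition′ R →
    ∀ {a b c d} → R (left a) b ≡ true → R (right c) d ≡ true → isLeft b ≡ isLeft d
  ∧-∨-targets-sameSide rc {b = left _}  {d = left _}  _  _  = refl
  ∧-∨-targets-sameSide rc {b = right _} {d = right _} _  _  = refl
  ∧-∨-targets-sameSide {R = R} rc {b = left b}  {d = right d} ab cd =
    let (t , res , tb , td) = ∨-resolutionThrough b d in
    ⊥-elim (∧-preimage-oneSided {R = R} rc res tb td ab cd)
  ∧-∨-targets-sameSide {R = R} rc {b = right b} {d = left d}  ab cd =
    let (t , res , td , tb) = ∨-resolutionThrough d b in
    ⊥-elim (∧-preimage-oneSided {R = R} rc res tb td ab cd)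

  seq-∧-∨ : Sequentialisable φ₁ (node ∨c ψ₁ ψ₂) → Sequentialisable φ₂ (node ∨c ψ₁ ψ₂) →
            Sequentialisable (node ∧c φ₁ φ₂) ψ₁ → Sequentialisable (node ∧c φ₁ φ₂) ψ₂ →
            Sequentialisable (node ∧c φ₁ φ₂) (node ∨c ψ₁ ψ₂)
  seq-∧-∨ seq₁ seq₂ seqˡ seqʳ R rc labels with edge? (sourceˡ R) | edge? (sourceʳ R)
  ... | inj₂ emptyˡ | _           = seq-∧L₂ R rc labels seq₂ emptyˡ
  ... | inj₁ _      | inj₂ emptyʳ = seq-∧L₁ R rc labels seq₁ emptyʳ
  ... | inj₁ (a , b , ab) | inj₁ (c , d , cd) = byTargetSide d targetsSide
    where
    targetsSide : ∀ x y → R x y ≡ true → isLeft y ≡ isLeft d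
    targetsSide (left x)  y xy = ∧-∨-targets-sameSide {R = R} rc xy cd
    targetsSide (right x) y xy =
      trans (sym (∧-∨-targets-sameSide {R = R} rc ab xy)) (∧-∨-targets-sameSide {R = R} rc ab cd)
    byTargetSide : ∀ d → (∀ x y → R x y ≡ true → isLeft y ≡ isLeft d) → DerivationOf R
    byTargetSide (left _)  side =
      seq-∨R₁ R rc labels seqˡ λ x y → ≢true⇒≡false λ xy → false≢true (side x (right y) xy)
    byTargetSide (right _) side =
      seq-∨R₂ R rc labels seqʳ λ x y → ≢true⇒≡false λ xy → false≢true (sym (side x (left y) xy))

  sequentialise : ∀ (φ ψ : Formula K) → Sequentialisable φ ψ
  sequentialise φ (node ∧c ψ₁ ψ₂) = seq-∧R (sequentialise φ ψ₁) (sequentialise φ ψ₂)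
  sequentialise (node ∨c φ₁ φ₂) ψ = seq-∨L (sequentialise φ₁ ψ) (sequentialise φ₂ ψ)
  sequentialise (atom k) (atom k') = seq-ax
  sequentialise (atom k) (node ∨c ψ₁ ψ₂) =
    seq-atom-∨ (sequentialise (atom k) ψ₁) (sequentialise (atom k) ψ₂)
  sequentialise (node ∧c φ₁ φ₂) (atom k) =
    seq-∧-atom (sequentialise φ₁ (atom k)) (sequentialise φ₂ (atom k))
  sequentialise (node ∧c φ₁ φ₂) (node ∨c ψ₁ ψ₂) =
    seq-∧-∨ (sequentialise φ₁ (node ∨c ψ₁ ψ₂)) (sequentialise φ₂ (node ∨c ψ₁ ψ₂))
            (sequentialise (node ∧c φ₁ φ₂) ψ₁) (sequentialise (node ∧c φ₁ φ₂) ψ₂)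

  -- Cut elimination

  compRel′ : Rel φ ψ → Rel ψ χ → Rel φ χ
  compRel′ {ψ = ψ} R R' x z = anyLeaf ψ (λ y → R x y ∧ R' y z)

  compRel≈compRel′ : ∀ (R : Rel φ ψ) (R' : Rel ψ χ) → compRel R R' ≈R compRel′ R R'
  compRel≈compRel′ {ψ = ψ} R R' x z = any-allLeaves ψ _

  mutual
    cut : φ ⊢ ψ → ψ ⊢ χ → φ ⊢ χ
    cut ax       e = e
    cut (∨L d₁ d₂) e = ∨L (cut d₁ e) (cut d₂ e)
    cut (∧L₁ d)  e = ∧L₁ (cut d e)
    cut (∧L₂ d)  e = ∧L₂ (cut d e)
    cut (∧R d₁ d₂) e = cut-∧R d₁ d₂ e
    cut (∨R₁ d)  e = cut-∨R₁ d e
    cut (∨R₂ d)  e = cut-∨R₂ d e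

    cut-∧R : φ ⊢ ψ₁ → φ ⊢ ψ₂ → node ∧c ψ₁ ψ₂ ⊢ χ → φ ⊢ χ
    cut-∧R d₁ d₂ (∧R e₁ e₂) = ∧R (cut-∧R d₁ d₂ e₁) (cut-∧R d₁ d₂ e₂)
    cut-∧R d₁ d₂ (∨R₁ e)    = ∨R₁ (cut-∧R d₁ d₂ e)
    cut-∧R d₁ d₂ (∨R₂ e)    = ∨R₂ (cut-∧R d₁ d₂ e)
    cut-∧R d₁ d₂ (∧L₁ e)    = cut d₁ e
    cut-∧R d₁ d₂ (∧L₂ e)    = cut d₂ e

    cut-∨R₁ : φ ⊢ ψ₁ → node ∨c ψ₁ ψ₂ ⊢ χ → φ ⊢ χ
    cut-∨R₁ d (∧R e₁ e₂) = ∧R (cut-∨R₁ d e₁) (cut-∨R₁ d e₂)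
    cut-∨R₁ d (∨R₁ e)    = ∨R₁ (cut-∨R₁ d e)
    cut-∨R₁ d (∨R₂ e)    = ∨R₂ (cut-∨R₁ d e)
    cut-∨R₁ d (∨L e₁ e₂) = cut d e₁

    cut-∨R₂ : φ ⊢ ψ₂ → node ∨c ψ₁ ψ₂ ⊢ χ → φ ⊢ χ
    cut-∨R₂ d (∧R e₁ e₂) = ∧R (cut-∨R₂ d e₁) (cut-∨R₂ d e₂)
    cut-∨R₂ d (∨R₁ e)    = ∨R₁ (cut-∨R₂ d e)
    cut-∨R₂ d (∨R₂ e)    = ∨R₂ (cut-∨R₂ d e)
    cut-∨R₂ d (∨L e₁ e₂) = cut d e₂

  mutual
    linking-cut : ∀ (d : φ ⊢ ψ) (e : ψ ⊢ χ) → linking (cut d e) ≈R compRel′ (linking d) (linking e)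
    linking-cut ax         e here      z = refl
    linking-cut (∨L d₁ d₂) e (left x)  z = linking-cut d₁ e x z
    linking-cut (∨L d₁ d₂) e (right x) z = linking-cut d₂ e x z
    linking-cut (∧L₁ d)    e (left x)  z = linking-cut d e x z
    linking-cut {ψ = ψ} (∧L₁ d) e (right x) z = sym (anyLeaf-false ψ _ λ _ → refl)
    linking-cut {ψ = ψ} (∧L₂ d) e (left x)  z = sym (anyLeaf-false ψ _ λ _ → refl)
    linking-cut (∧L₂ d)    e (right x) z = linking-cut d e x z
    linking-cut (∧R d₁ d₂) e = linking-cut-∧R d₁ d₂ e
    linking-cut (∨R₁ d)    e = linking-cut-∨R₁ d e
    linking-cut (∨R₂ d)    e = linking-cut-∨R₂ d e

    linking-cut-∧R : ∀ (d₁ : φ ⊢ ψ₁) (d₂ : φ ⊢ ψ₂) (e : node ∧c ψ₁ ψ₂ ⊢ χ) →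
                     linking (cut-∧R d₁ d₂ e) ≈R compRel′ (linking (∧R d₁ d₂)) (linking e)
    linking-cut-∧R d₁ d₂ (∧R e₁ e₂) x (left z)  = linking-cut-∧R d₁ d₂ e₁ x z
    linking-cut-∧R d₁ d₂ (∧R e₁ e₂) x (right z) = linking-cut-∧R d₁ d₂ e₂ x z
    linking-cut-∧R d₁ d₂ (∨R₁ e)    x (left z)  = linking-cut-∧R d₁ d₂ e x z
    linking-cut-∧R {ψ₁ = ψ₁} {ψ₂} d₁ d₂ (∨R₁ e) x (right z) =
      sym (cong₂ _∨_ (anyLeaf-∧-emptyʳ ψ₁ _ λ _ → refl) (anyLeaf-∧-emptyʳ ψ₂ _ λ _ → refl))
    linking-cut-∧R {ψ₁ = ψ₁} {ψ₂} d₁ d₂ (∨R₂ e) x (left z) =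
      sym (cong₂ _∨_ (anyLeaf-∧-emptyʳ ψ₁ _ λ _ → refl) (anyLeaf-∧-emptyʳ ψ₂ _ λ _ → refl))
    linking-cut-∧R d₁ d₂ (∨R₂ e)    x (right z) = linking-cut-∧R d₁ d₂ e x z
    linking-cut-∧R {ψ₂ = ψ₂} d₁ d₂ (∧L₁ e) x z =
      trans (linking-cut d₁ e x z) (sym (∨-falseʳ (anyLeaf-∧-emptyʳ ψ₂ _ λ _ → refl)))
    linking-cut-∧R {ψ₁ = ψ₁} d₁ d₂ (∧L₂ e) x z =
      trans (linking-cut d₂ e x z) (sym (∨-falseˡ (anyLeaf-∧-emptyʳ ψ₁ _ λ _ → refl)))

    linking-cut-∨R₁ : ∀ (d : φ ⊢ ψ₁) (e : node ∨c ψ₁ ψ₂ ⊢ χ) →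
                      linking (cut-∨R₁ d e) ≈R compRel′ (linking (∨R₁ {ψ₂ = ψ₂} d)) (linking e)
    linking-cut-∨R₁ d (∧R e₁ e₂) x (left z)  = linking-cut-∨R₁ d e₁ x z
    linking-cut-∨R₁ d (∧R e₁ e₂) x (right z) = linking-cut-∨R₁ d e₂ x z
    linking-cut-∨R₁ d (∨R₁ e)    x (left z)  = linking-cut-∨R₁ d e x z
    linking-cut-∨R₁ {ψ₁ = ψ₁} {ψ₂} d (∨R₁ e) x (right z) =
      sym (cong₂ _∨_ (anyLeaf-∧-emptyʳ ψ₁ _ λ _ → refl) (anyLeaf-false ψ₂ _ λ _ → refl))
    linking-cut-∨R₁ {ψ₁ = ψ₁} {ψ₂} d (∨R₂ e) x (left z) =
      sym (cong₂ _∨_ (anyLeaf-∧-emptyʳ ψ₁ _ λ _ → refl) (anyLeaf-false ψ₂ _ λ _ → refl))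
    linking-cut-∨R₁ d (∨R₂ e)    x (right z) = linking-cut-∨R₁ d e x z
    linking-cut-∨R₁ {ψ₂ = ψ₂} d (∨L e₁ e₂) x z =
      trans (linking-cut d e₁ x z) (sym (∨-falseʳ (anyLeaf-false ψ₂ _ λ _ → refl)))

    linking-cut-∨R₂ : ∀ (d : φ ⊢ ψ₂) (e : node ∨c ψ₁ ψ₂ ⊢ χ) →
                      linking (cut-∨R₂ d e) ≈R compRel′ (linking (∨R₂ {ψ₁ = ψ₁} d)) (linking e)
    linking-cut-∨R₂ d (∧R e₁ e₂) x (left z)  = linking-cut-∨R₂ d e₁ x z
    linking-cut-∨R₂ d (∧R e₁ e₂) x (right z) = linking-cut-∨R₂ d e₂ x z
    linking-cut-∨R₂ d (∨R₁ e)    x (left z)  = linking-cut-∨R₂ d e x z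
    linking-cut-∨R₂ {ψ₂ = ψ₂} {ψ₁} d (∨R₁ e) x (right z) =
      sym (cong₂ _∨_ (anyLeaf-false ψ₁ _ λ _ → refl) (anyLeaf-∧-emptyʳ ψ₂ _ λ _ → refl))
    linking-cut-∨R₂ {ψ₂ = ψ₂} {ψ₁} d (∨R₂ e) x (left z) =
      sym (cong₂ _∨_ (anyLeaf-false ψ₁ _ λ _ → refl) (anyLeaf-∧-emptyʳ ψ₂ _ λ _ → refl))
    linking-cut-∨R₂ d (∨R₂ e)    x (right z) = linking-cut-∨R₂ d e x z
    linking-cut-∨R₂ {ψ₁ = ψ₁} d (∨L e₁ e₂) x z =
      trans (linking-cut d e₂ x z) (sym (∨-falseˡ (anyLeaf-false ψ₁ _ λ _ → refl)))

  id⊢ : ∀ (φ : Formula K) → φ ⊢ φ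
  id⊢ (atom k)      = ax
  id⊢ (node ∧c φ ψ) = ∧R (∧L₁ (id⊢ φ)) (∧L₂ (id⊢ ψ))
  id⊢ (node ∨c φ ψ) = ∨L (∨R₁ (id⊢ φ)) (∨R₂ (id⊢ ψ))

  linking-id⊢ : ∀ (φ : Formula K) → linking (id⊢ φ) ≈R idRel
  linking-id⊢ (atom k)      here      here      = refl
  linking-id⊢ (node ∧c φ ψ) (left x)  (left y)  = linking-id⊢ φ x y
  linking-id⊢ (node ∧c φ ψ) (left x)  (right y) = refl
  linking-id⊢ (node ∧c φ ψ) (right x) (left y)  = refl
  linking-id⊢ (node ∧c φ ψ) (right x) (right y) = linking-id⊢ ψ x y
  linking-id⊢ (node ∨c φ ψ) (left x)  (left y)  = linking-id⊢ φ x y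
  linking-id⊢ (node ∨c φ ψ) (left x)  (right y) = refl
  linking-id⊢ (node ∨c φ ψ) (right x) (left y)  = refl
  linking-id⊢ (node ∨c φ ψ) (right x) (right y) = linking-id⊢ ψ x y

  anyLeaf-∧-eqLeaf : ∀ (φ : Formula K) (p : Leaf φ → Bool) y → anyLeaf φ (λ x → p x ∧ eqLeaf x y) ≡ p y
  anyLeaf-∧-eqLeaf φ p y = ≡-from-true⇔true
    (λ e → let (x , px , x≡y) = anyLeaf-∧-elim φ p (λ x → eqLeaf x y) e
           in subst (λ z → p z ≡ true) (eqLeaf⇒≡ x y x≡y) px)
    (λ py → anyLeaf-∧-intro φ p (λ x → eqLeaf x y) y py (eqLeaf-refl y))

  anyLeaf-eqLeaf-∧ : ∀ (φ : Formula K) (p : Leaf φ → Bool) x → anyLeaf φ (λ y → eqLeaf x y ∧ p y) ≡ p x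
  anyLeaf-eqLeaf-∧ φ p x = ≡-from-true⇔true
    (λ e → let (y , x≡y , py) = anyLeaf-∧-elim φ (eqLeaf x) p e
           in subst (λ z → p z ≡ true) (sym (eqLeaf⇒≡ x y x≡y)) py)
    (λ px → anyLeaf-∧-intro φ (eqLeaf x) p x (eqLeaf-refl x) px)

  -- CW_K is a category

  ≈R-isEquivalence : IsEquivalence (_≈R_ {φ = φ} {ψ = ψ})
  ≈R-isEquivalence = record
    { refl  = λ _ _ → refl
    ; sym   = λ R≈S x y → sym (R≈S x y)
    ; trans = λ R≈S S≈T x y → trans (R≈S x y) (S≈T x y) }

  compRel′-cong : ∀ {R S : Rel φ ψ} {R' S' : Rel ψ χ} → R ≈R S → R' ≈R S' →
                  compRel′ R R' ≈R compRel′ S S'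
  compRel′-cong {ψ = ψ} R≈S R'≈S' x z = anyLeaf-cong ψ λ y → cong₂ _∧_ (R≈S x y) (R'≈S' y z)

  compRel-cong : ∀ {R S : Rel φ ψ} {R' S' : Rel ψ χ} → R ≈R S → R' ≈R S' →
                 compRel R R' ≈R compRel S S'
  compRel-cong {R = R} {S} {R'} {S'} R≈S R'≈S' x z =
    trans (compRel≈compRel′ R R' x z)
          (trans (compRel′-cong R≈S R'≈S' x z) (sym (compRel≈compRel′ S S' x z)))

  compRel-identityˡ : ∀ (R : Rel φ ψ) → compRel R idRel ≈R R
  compRel-identityˡ {ψ = ψ} R x z = trans (compRel≈compRel′ R idRel x z) (anyLeaf-∧-eqLeaf ψ (R x) z)

  compRel-identityʳ : ∀ (R : Rel φ ψ) → compRel idRel R ≈R R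
  compRel-identityʳ {φ = φ} R x z =
    trans (compRel≈compRel′ idRel R x z) (anyLeaf-eqLeaf-∧ φ (λ y → R y z) x)

  compRel′-assoc : ∀ (R : Rel φ ψ) (R' : Rel ψ χ) (R'' : Rel χ ω) →
                   compRel′ R (compRel′ R' R'') ≈R compRel′ (compRel′ R R') R''
  compRel′-assoc {ψ = ψ} {χ = χ} R R' R'' x w = ≡-from-true⇔true
    (λ e → let (y , xy , yw) = anyLeaf-∧-elim ψ (R x) (λ y → compRel′ R' R'' y w) e
               (z , yz , zw) = anyLeaf-∧-elim χ (R' y) (λ z → R'' z w) yw
           in anyLeaf-∧-intro χ (compRel′ R R' x) (λ z → R'' z w) z
                (anyLeaf-∧-intro ψ (R x) (λ y → R' y z) y xy yz) zw)
    (λ e → let (z , xz , zw) = anyLeaf-∧-elim χ (compRel′ R R' x) (λ z → R'' z w) e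
               (y , xy , yz) = anyLeaf-∧-elim ψ (R x) (λ y → R' y z) xz
           in anyLeaf-∧-intro ψ (R x) (λ y → compRel′ R' R'' y w) y xy
                (anyLeaf-∧-intro χ (R' y) (λ z → R'' z w) z yz zw))

  compRel-assoc : ∀ (R : Rel φ ψ) (R' : Rel ψ χ) (R'' : Rel χ ω) →
                  compRel R (compRel R' R'') ≈R compRel (compRel R R') R''
  compRel-assoc R R' R'' x w = begin
    compRel R (compRel R' R'') x w
      ≡⟨ compRel≈compRel′ R (compRel R' R'') x w ⟩
    compRel′ R (compRel R' R'') x w
      ≡⟨ compRel′-cong {R = R} {S = R} (λ _ _ → refl) (compRel≈compRel′ R' R'') x w ⟩
    compRel′ R (compRel′ R' R'') x w
      ≡⟨ compRel′-assoc R R' R'' x w ⟩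
    compRel′ (compRel′ R R') R'' x w
      ≡⟨ compRel′-cong {R' = R''} {S' = R''} (λ a b → sym (compRel≈compRel′ R R' a b)) (λ _ _ → refl) x w ⟩
    compRel′ (compRel R R') R'' x w
      ≡⟨ sym (compRel≈compRel′ (compRel R R') R'' x w) ⟩
    compRel (compRel R R') R'' x w ∎
    where open ≡-Reasoning

  compRel-respectsLabels : ∀ (R : Rel φ ψ) (R' : Rel ψ χ) → RespectsLabels R → RespectsLabels R' →
                           RespectsLabels (compRel R R')
  compRel-respectsLabels {ψ = ψ} R R' labels labels' x z xz =
    let (y , xy , yz) = anyLeaf-∧-elim ψ (R x) (λ y → R' y z) (trans (sym (compRel≈compRel′ R R' x z)) xz)
    in trans (labels x y xy) (labels' y z yz)

  preimage′-compRel′ : ∀ (R : Rel φ ψ) (R' : Rel ψ χ) t →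
                       preimage′ R (preimage′ R' t) ≐ preimage′ (compRel′ R R') t
  preimage′-compRel′ {ψ = ψ} {χ = χ} R R' t x = ≡-from-true⇔true
    (λ e → let (y , ty , xy) = anyLeaf-∧-elim ψ (preimage′ R' t) (R x) e
               (z , tz , yz) = anyLeaf-∧-elim χ t (R' y) ty
           in anyLeaf-∧-intro χ t (compRel′ R R' x) z tz (anyLeaf-∧-intro ψ (R x) (λ y → R' y z) y xy yz))
    (λ e → let (z , tz , xz) = anyLeaf-∧-elim χ t (compRel′ R R' x) e
               (y , xy , yz) = anyLeaf-∧-elim ψ (R x) (λ y → R' y z) xz
           in anyLeaf-∧-intro ψ (preimage′ R' t) (R x) y (anyLeaf-∧-intro χ t (R' y) z tz yz) xy)

  image′-compRel′ : ∀ (R : Rel φ ψ) (R' : Rel ψ χ) α →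
                    image′ R' (image′ R α) ≐ image′ (compRel′ R R') α
  image′-compRel′ {φ = φ} {ψ = ψ} R R' α z = ≡-from-true⇔true
    (λ e → let (y , αy , yz) = anyLeaf-∧-elim ψ (image′ R α) (λ y → R' y z) e
               (x , αx , xy) = anyLeaf-∧-elim φ α (λ x → R x y) αy
           in anyLeaf-∧-intro φ α (λ x → compRel′ R R' x z) x αx
                (anyLeaf-∧-intro ψ (R x) (λ y → R' y z) y xy yz))
    (λ e → let (x , αx , xz) = anyLeaf-∧-elim φ α (λ x → compRel′ R R' x z) e
               (y , xy , yz) = anyLeaf-∧-elim ψ (R x) (λ y → R' y z) xz
           in anyLeaf-∧-intro ψ (image′ R α) (λ y → R' y z) y
                (anyLeaf-∧-intro φ α (λ x → R x y) x αx xy) yz)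

  compRel′-resCond : ∀ {R : Rel φ ψ} {R' : Rel ψ χ} →
    ResolutionCondition′ R → ResolutionCondition′ R' → ResolutionCondition′ (compRel′ R R')
  compRel′-resCond {R = R} {R'} (pre , img) (pre' , img') =
    (λ t res → IsResolution-resp (preimage′-compRel′ R R' t) (pre _ (pre' t res))) ,
    (λ α perp → InPerp-resp (image′-compRel′ R R' α) (img' _ (img α perp)))

  cwFacts : CWFacts K
  cwFacts = record
    { id-labels   = λ x y x≡y → cong label (eqLeaf⇒≡ x y x≡y)
    ; id-res      = λ {φ} → ResolutionCondition′⇒ResolutionCondition
        (ResolutionCondition′-resp (linking-id⊢ φ) (linking-resCond (id⊢ φ)))
    ; comp-labels = compRel-respectsLabels
    ; comp-res    = λ R R' rc rc' → ResolutionCondition′⇒ResolutionCondition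
        (ResolutionCondition′-resp (λ x z → sym (compRel≈compRel′ R R' x z))
          (compRel′-resCond (ResolutionCondition⇒ResolutionCondition′ rc)
                            (ResolutionCondition⇒ResolutionCondition′ rc')))
    ; ≈R-equiv    = ≈R-isEquivalence
    ; comp-resp   = compRel-cong
    ; comp-idˡ    = compRel-identityˡ
    ; comp-idʳ    = compRel-identityʳ
    ; comp-assoc  = compRel-assoc
    }

  CWK : Category _ _ _
  CWK = CW K cwFacts

  compRel′-emptyʳ : ∀ (R : Rel φ ψ) → compRel′ R (emptyRel {ψ = χ}) ≈R emptyRel
  compRel′-emptyʳ {ψ = ψ} R x z = anyLeaf-∧-emptyʳ ψ (R x) λ _ → refl

  compRel′-emptyˡ : ∀ (R : Rel ψ χ) → compRel′ (emptyRel {φ = φ}) R ≈R emptyRel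
  compRel′-emptyˡ {ψ = ψ} R x z = anyLeaf-false ψ _ λ _ → refl

  compRel′-id⊢ʳ : ∀ (R : Rel φ ψ) → compRel′ R (linking (id⊢ ψ)) ≈R R
  compRel′-id⊢ʳ {ψ = ψ} R x z =
    trans (compRel′-cong {R = R} (λ _ _ → refl) (linking-id⊢ ψ) x z) (anyLeaf-∧-eqLeaf ψ (R x) z)

  compRel′-id⊢ˡ : ∀ (R : Rel φ ψ) → compRel′ (linking (id⊢ φ)) R ≈R R
  compRel′-id⊢ˡ {φ = φ} R x z =
    trans (compRel′-cong {R' = R} (linking-id⊢ φ) (λ _ _ → refl) x z) (anyLeaf-eqLeaf-∧ φ (λ y → R y z) x)

  compRel′-π₁ : ∀ (R : Rel χ (node ∧c ψ₁ ψ₂)) → compRel′ R (linking (∧L₁ {φ₂ = ψ₂} (id⊢ ψ₁))) ≈R targetˡ R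
  compRel′-π₁ R x y = trans (∨-falseʳ (compRel′-emptyʳ (targetʳ R) x y)) (compRel′-id⊢ʳ (targetˡ R) x y)

  compRel′-π₂ : ∀ (R : Rel χ (node ∧c ψ₁ ψ₂)) → compRel′ R (linking (∧L₂ {φ₁ = ψ₁} (id⊢ ψ₂))) ≈R targetʳ R
  compRel′-π₂ R x y = trans (∨-falseˡ (compRel′-emptyʳ (targetˡ R) x y)) (compRel′-id⊢ʳ (targetʳ R) x y)

  compRel′-ι₁ : ∀ (R : Rel (node ∨c φ₁ φ₂) χ) → compRel′ (linking (∨R₁ {ψ₂ = φ₂} (id⊢ φ₁))) R ≈R sourceˡ R
  compRel′-ι₁ R x y = trans (∨-falseʳ (compRel′-emptyˡ (sourceʳ R) x y)) (compRel′-id⊢ˡ (sourceˡ R) x y)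

  compRel′-ι₂ : ∀ (R : Rel (node ∨c φ₁ φ₂) χ) → compRel′ (linking (∨R₂ {ψ₁ = φ₁} (id⊢ φ₂))) R ≈R sourceʳ R
  compRel′-ι₂ R x y = trans (∨-falseˡ (compRel′-emptyˡ (sourceˡ R) x y)) (compRel′-id⊢ˡ (sourceʳ R) x y)

  compRel′-π₁-pre : ∀ (R : Rel φ₁ χ) →
    compRel′ (linking (∧L₁ {φ₂ = φ₂} (id⊢ φ₁))) R ≈R joinSource R emptyRel
  compRel′-π₁-pre R (left x)  y = compRel′-id⊢ˡ R x y
  compRel′-π₁-pre R (right x) y = compRel′-emptyˡ R x y

  compRel′-π₂-pre : ∀ (R : Rel φ₂ χ) →
    compRel′ (linking (∧L₂ {φ₁ = φ₁} (id⊢ φ₂))) R ≈R joinSource emptyRel R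
  compRel′-π₂-pre R (left x)  y = compRel′-emptyˡ R x y
  compRel′-π₂-pre R (right x) y = compRel′-id⊢ˡ R x y

  compRel′-ι₁-post : ∀ (R : Rel χ ψ₁) →
    compRel′ R (linking (∨R₁ {ψ₂ = ψ₂} (id⊢ ψ₁))) ≈R joinTarget R emptyRel
  compRel′-ι₁-post R x (left y)  = compRel′-id⊢ʳ R x y
  compRel′-ι₁-post R x (right y) = compRel′-emptyʳ R x y

  compRel′-ι₂-post : ∀ (R : Rel χ ψ₂) →
    compRel′ R (linking (∨R₂ {ψ₁ = ψ₁} (id⊢ ψ₂))) ≈R joinTarget emptyRel R
  compRel′-ι₂-post R x (left y)  = compRel′-emptyʳ R x y
  compRel′-ι₂-post R x (right y) = compRel′-id⊢ʳ R x y


  -- Interpretation in a category with products and coproducts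

  module Interpretation (C : Category o ℓ e) (products : HasBinaryProducts C)
                        (coproducts : HasBinaryCoproducts C) (gen₀ : K → Category.Obj C) where
    open CategoryProperties C
    private module Cᵒᵖ = CategoryProperties (op C)

    infixr 22 _×ᶜ_
    infixr 21 _+ᶜ_

    _×ᶜ_ : Obj → Obj → Obj
    A ×ᶜ B = proj₁ (products A B)

    π₁ : ∀ {A B} → A ×ᶜ B ⇒ A
    π₁ {A} {B} = proj₁ (proj₂ (products A B))

    π₂ : ∀ {A B} → A ×ᶜ B ⇒ B
    π₂ {A} {B} = proj₁ (proj₂ (proj₂ (products A B)))

    ×-isProduct : ∀ A B → IsProduct C (π₁ {A} {B}) π₂
    ×-isProduct A B = proj₂ (proj₂ (proj₂ (products A B)))

    ⟨_,_⟩ : ∀ {X A B} → X ⇒ A → X ⇒ B → X ⇒ A ×ᶜ B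
    ⟨ f , g ⟩ = proj₁ (×-isProduct _ _ f g)

    project₁ : ∀ {X A B} {f : X ⇒ A} {g : X ⇒ B} → π₁ ∘ ⟨ f , g ⟩ ≈ f
    project₁ {f = f} {g} = proj₁ (proj₂ (×-isProduct _ _ f g))

    project₂ : ∀ {X A B} {f : X ⇒ A} {g : X ⇒ B} → π₂ ∘ ⟨ f , g ⟩ ≈ g
    project₂ {f = f} {g} = proj₁ (proj₂ (proj₂ (×-isProduct _ _ f g)))

    product-ext : ∀ {X A B} {h h' : X ⇒ A ×ᶜ B} → π₁ ∘ h ≈ π₁ ∘ h' → π₂ ∘ h ≈ π₂ ∘ h' → h ≈ h'
    product-ext {A = A} {B} {h} {h'} = IsProduct-ext (×-isProduct A B) h h'

    _+ᶜ_ : Obj → Obj → Obj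
    A +ᶜ B = proj₁ (coproducts A B)

    ι₁ : ∀ {A B} → A ⇒ A +ᶜ B
    ι₁ {A} {B} = proj₁ (proj₂ (coproducts A B))

    ι₂ : ∀ {A B} → B ⇒ A +ᶜ B
    ι₂ {A} {B} = proj₁ (proj₂ (proj₂ (coproducts A B)))

    +-isCoproduct : ∀ A B → IsCoproduct C (ι₁ {A} {B}) ι₂
    +-isCoproduct A B = proj₂ (proj₂ (proj₂ (coproducts A B)))

    [_,_] : ∀ {X A B} → A ⇒ X → B ⇒ X → A +ᶜ B ⇒ X
    [ f , g ] = proj₁ (+-isCoproduct _ _ f g)

    inject₁ : ∀ {X A B} {f : A ⇒ X} {g : B ⇒ X} → [ f , g ] ∘ ι₁ ≈ f
    inject₁ {f = f} {g} = proj₁ (proj₂ (+-isCoproduct _ _ f g))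

    inject₂ : ∀ {X A B} {f : A ⇒ X} {g : B ⇒ X} → [ f , g ] ∘ ι₂ ≈ g
    inject₂ {f = f} {g} = proj₁ (proj₂ (proj₂ (+-isCoproduct _ _ f g)))

    coproduct-ext : ∀ {X A B} {h h' : A +ᶜ B ⇒ X} → h ∘ ι₁ ≈ h' ∘ ι₁ → h ∘ ι₂ ≈ h' ∘ ι₂ → h ≈ h'
    coproduct-ext {A = A} {B} {h} {h'} = Cᵒᵖ.IsProduct-ext (+-isCoproduct A B) h h'

    ⟦_⟧ : Formula K → Obj
    ⟦ atom k ⟧        = gen₀ k
    ⟦ node ∧c φ ψ ⟧ = ⟦ φ ⟧ ×ᶜ ⟦ ψ ⟧
    ⟦ node ∨c φ ψ ⟧ = ⟦ φ ⟧ +ᶜ ⟦ ψ ⟧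

    ⟦_⟧⊢ : φ ⊢ ψ → ⟦ φ ⟧ ⇒ ⟦ ψ ⟧
    ⟦ ax ⟧⊢       = id
    ⟦ ∧R d e ⟧⊢ = ⟨ ⟦ d ⟧⊢ , ⟦ e ⟧⊢ ⟩
    ⟦ ∨L d e ⟧⊢ = [ ⟦ d ⟧⊢ , ⟦ e ⟧⊢ ]
    ⟦ ∧L₁ d ⟧⊢  = ⟦ d ⟧⊢ ∘ π₁
    ⟦ ∧L₂ d ⟧⊢  = ⟦ d ⟧⊢ ∘ π₂
    ⟦ ∨R₁ d ⟧⊢  = ι₁ ∘ ⟦ d ⟧⊢
    ⟦ ∨R₂ d ⟧⊢  = ι₂ ∘ ⟦ d ⟧⊢

    mutual
      ⟦cut⟧ : ∀ (d : φ ⊢ ψ) (e : ψ ⊢ χ) → ⟦ cut d e ⟧⊢ ≈ ⟦ e ⟧⊢ ∘ ⟦ d ⟧⊢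
      ⟦cut⟧ ax         e = ≈.sym identityʳ
      ⟦cut⟧ (∨L d₁ d₂) e = coproduct-ext
        (inject₁ ∙ ⟦cut⟧ d₁ e ∙ ≈.sym (assoc ∙ ∘-resp-≈ʳ inject₁))
        (inject₂ ∙ ⟦cut⟧ d₂ e ∙ ≈.sym (assoc ∙ ∘-resp-≈ʳ inject₂))
      ⟦cut⟧ (∧L₁ d)    e = ∘-resp-≈ˡ (⟦cut⟧ d e) ∙ assoc
      ⟦cut⟧ (∧L₂ d)    e = ∘-resp-≈ˡ (⟦cut⟧ d e) ∙ assoc
      ⟦cut⟧ (∧R d₁ d₂) e = ⟦cut-∧R⟧ d₁ d₂ e
      ⟦cut⟧ (∨R₁ d)    e = ⟦cut-∨R₁⟧ d e
      ⟦cut⟧ (∨R₂ d)    e = ⟦cut-∨R₂⟧ d e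

      ⟦cut-∧R⟧ : ∀ (d₁ : φ ⊢ ψ₁) (d₂ : φ ⊢ ψ₂) (e : node ∧c ψ₁ ψ₂ ⊢ χ) →
                 ⟦ cut-∧R d₁ d₂ e ⟧⊢ ≈ ⟦ e ⟧⊢ ∘ ⟦ ∧R d₁ d₂ ⟧⊢
      ⟦cut-∧R⟧ d₁ d₂ (∧R e₁ e₂) = product-ext
        (project₁ ∙ ⟦cut-∧R⟧ d₁ d₂ e₁ ∙ ≈.sym (sym-assoc ∙ ∘-resp-≈ˡ project₁))
        (project₂ ∙ ⟦cut-∧R⟧ d₁ d₂ e₂ ∙ ≈.sym (sym-assoc ∙ ∘-resp-≈ˡ project₂))
      ⟦cut-∧R⟧ d₁ d₂ (∨R₁ e) = ∘-resp-≈ʳ (⟦cut-∧R⟧ d₁ d₂ e) ∙ sym-assoc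
      ⟦cut-∧R⟧ d₁ d₂ (∨R₂ e) = ∘-resp-≈ʳ (⟦cut-∧R⟧ d₁ d₂ e) ∙ sym-assoc
      ⟦cut-∧R⟧ d₁ d₂ (∧L₁ e) = ⟦cut⟧ d₁ e ∙ ∘-resp-≈ʳ (≈.sym project₁) ∙ sym-assoc
      ⟦cut-∧R⟧ d₁ d₂ (∧L₂ e) = ⟦cut⟧ d₂ e ∙ ∘-resp-≈ʳ (≈.sym project₂) ∙ sym-assoc

      ⟦cut-∨R₁⟧ : ∀ (d : φ ⊢ ψ₁) (e : node ∨c ψ₁ ψ₂ ⊢ χ) →
                  ⟦ cut-∨R₁ d e ⟧⊢ ≈ ⟦ e ⟧⊢ ∘ ⟦ ∨R₁ {ψ₂ = ψ₂} d ⟧⊢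
      ⟦cut-∨R₁⟧ d (∧R e₁ e₂) = product-ext
        (project₁ ∙ ⟦cut-∨R₁⟧ d e₁ ∙ ≈.sym (sym-assoc ∙ ∘-resp-≈ˡ project₁))
        (project₂ ∙ ⟦cut-∨R₁⟧ d e₂ ∙ ≈.sym (sym-assoc ∙ ∘-resp-≈ˡ project₂))
      ⟦cut-∨R₁⟧ d (∨R₁ e)    = ∘-resp-≈ʳ (⟦cut-∨R₁⟧ d e) ∙ sym-assoc
      ⟦cut-∨R₁⟧ d (∨R₂ e)    = ∘-resp-≈ʳ (⟦cut-∨R₁⟧ d e) ∙ sym-assoc
      ⟦cut-∨R₁⟧ d (∨L e₁ e₂) = ⟦cut⟧ d e₁ ∙ ∘-resp-≈ˡ (≈.sym inject₁) ∙ assoc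

      ⟦cut-∨R₂⟧ : ∀ (d : φ ⊢ ψ₂) (e : node ∨c ψ₁ ψ₂ ⊢ χ) →
                  ⟦ cut-∨R₂ d e ⟧⊢ ≈ ⟦ e ⟧⊢ ∘ ⟦ ∨R₂ {ψ₁ = ψ₁} d ⟧⊢
      ⟦cut-∨R₂⟧ d (∧R e₁ e₂) = product-ext
        (project₁ ∙ ⟦cut-∨R₂⟧ d e₁ ∙ ≈.sym (sym-assoc ∙ ∘-resp-≈ˡ project₁))
        (project₂ ∙ ⟦cut-∨R₂⟧ d e₂ ∙ ≈.sym (sym-assoc ∙ ∘-resp-≈ˡ project₂))
      ⟦cut-∨R₂⟧ d (∨R₁ e)    = ∘-resp-≈ʳ (⟦cut-∨R₂⟧ d e) ∙ sym-assoc
      ⟦cut-∨R₂⟧ d (∨R₂ e)    = ∘-resp-≈ʳ (⟦cut-∨R₂⟧ d e) ∙ sym-assoc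
      ⟦cut-∨R₂⟧ d (∨L e₁ e₂) = ⟦cut⟧ d e₂ ∙ ∘-resp-≈ˡ (≈.sym inject₂) ∙ assoc

    ⟦id⊢⟧ : ∀ (φ : Formula K) → ⟦ id⊢ φ ⟧⊢ ≈ id
    ⟦id⊢⟧ (atom k)      = ≈.refl
    ⟦id⊢⟧ (node ∧c φ ψ) = product-ext
      (project₁ ∙ ∘-resp-≈ˡ (⟦id⊢⟧ φ) ∙ identityˡ ∙ ≈.sym identityʳ)
      (project₂ ∙ ∘-resp-≈ˡ (⟦id⊢⟧ ψ) ∙ identityˡ ∙ ≈.sym identityʳ)
    ⟦id⊢⟧ (node ∨c φ ψ) = coproduct-ext
      (inject₁ ∙ ∘-resp-≈ʳ (⟦id⊢⟧ φ) ∙ identityʳ ∙ ≈.sym identityˡ)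
      (inject₂ ∙ ∘-resp-≈ʳ (⟦id⊢⟧ ψ) ∙ identityʳ ∙ ≈.sym identityˡ)

  -- Coherence

  post-π₁ : φ ⊢ node ∧c ψ₁ ψ₂ → φ ⊢ ψ₁
  post-π₁ {ψ₁ = ψ₁} d = cut d (∧L₁ (id⊢ ψ₁))

  post-π₂ : φ ⊢ node ∧c ψ₁ ψ₂ → φ ⊢ ψ₂
  post-π₂ {ψ₂ = ψ₂} d = cut d (∧L₂ (id⊢ ψ₂))

  pre-ι₁ : node ∨c φ₁ φ₂ ⊢ ψ → φ₁ ⊢ ψ
  pre-ι₁ {φ₁ = φ₁} d = cut (∨R₁ (id⊢ φ₁)) d

  pre-ι₂ : node ∨c φ₁ φ₂ ⊢ ψ → φ₂ ⊢ ψ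
  pre-ι₂ {φ₂ = φ₂} d = cut (∨R₂ (id⊢ φ₂)) d

  linking-post-π₁ : ∀ (d : φ ⊢ node ∧c ψ₁ ψ₂) → linking (post-π₁ d) ≈R targetˡ (linking d)
  linking-post-π₁ d x y = trans (linking-cut d _ x y) (compRel′-π₁ (linking d) x y)

  linking-post-π₂ : ∀ (d : φ ⊢ node ∧c ψ₁ ψ₂) → linking (post-π₂ d) ≈R targetʳ (linking d)
  linking-post-π₂ d x y = trans (linking-cut d _ x y) (compRel′-π₂ (linking d) x y)

  linking-pre-ι₁ : ∀ (d : node ∨c φ₁ φ₂ ⊢ ψ) → linking (pre-ι₁ d) ≈R sourceˡ (linking d)
  linking-pre-ι₁ {φ₁ = φ₁} {φ₂ = φ₂} d x y =
    trans (linking-cut (∨R₁ {ψ₂ = φ₂} (id⊢ φ₁)) d x y) (compRel′-ι₁ (linking d) x y)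

  linking-pre-ι₂ : ∀ (d : node ∨c φ₁ φ₂ ⊢ ψ) → linking (pre-ι₂ d) ≈R sourceʳ (linking d)
  linking-pre-ι₂ {φ₁ = φ₁} {φ₂ = φ₂} d x y =
    trans (linking-cut (∨R₂ {ψ₁ = φ₁} (id⊢ φ₂)) d x y) (compRel′-ι₂ (linking d) x y)

  linking-nonempty-absurd : ∀ (d : φ ⊢ ψ) → IsEmptyRel (linking d) → ⊥
  linking-nonempty-absurd d empty =
    let (x , y , xy) = linking-nonempty d in true-false-absurd xy (empty x y)

  module Coherence (C : Category o ℓ e) (products : HasBinaryProducts C)
                   (coproducts : HasBinaryCoproducts C) (gen₀ : K → Category.Obj C) where
    open CategoryProperties C
    open Interpretation C products coproducts gen₀

    ⟦post-π₁⟧ : ∀ (d : φ ⊢ node ∧c ψ₁ ψ₂) → ⟦ post-π₁ d ⟧⊢ ≈ π₁ ∘ ⟦ d ⟧⊢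
    ⟦post-π₁⟧ {ψ₁ = ψ₁} {ψ₂ = ψ₂} d = ⟦cut⟧ d (∧L₁ {φ₂ = ψ₂} (id⊢ ψ₁))
      ∙ ∘-resp-≈ˡ (∘-resp-≈ˡ (⟦id⊢⟧ ψ₁) ∙ identityˡ)

    ⟦post-π₂⟧ : ∀ (d : φ ⊢ node ∧c ψ₁ ψ₂) → ⟦ post-π₂ d ⟧⊢ ≈ π₂ ∘ ⟦ d ⟧⊢
    ⟦post-π₂⟧ {ψ₁ = ψ₁} {ψ₂ = ψ₂} d = ⟦cut⟧ d (∧L₂ {φ₁ = ψ₁} (id⊢ ψ₂))
      ∙ ∘-resp-≈ˡ (∘-resp-≈ˡ (⟦id⊢⟧ ψ₂) ∙ identityˡ)

    ⟦pre-ι₁⟧ : ∀ (d : node ∨c φ₁ φ₂ ⊢ ψ) → ⟦ pre-ι₁ d ⟧⊢ ≈ ⟦ d ⟧⊢ ∘ ι₁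
    ⟦pre-ι₁⟧ {φ₁ = φ₁} {φ₂ = φ₂} d = ⟦cut⟧ (∨R₁ {ψ₂ = φ₂} (id⊢ φ₁)) d
      ∙ ∘-resp-≈ʳ (∘-resp-≈ʳ (⟦id⊢⟧ φ₁) ∙ identityʳ)

    ⟦pre-ι₂⟧ : ∀ (d : node ∨c φ₁ φ₂ ⊢ ψ) → ⟦ pre-ι₂ d ⟧⊢ ≈ ⟦ d ⟧⊢ ∘ ι₂
    ⟦pre-ι₂⟧ {φ₁ = φ₁} {φ₂ = φ₂} d = ⟦cut⟧ (∨R₂ {ψ₁ = φ₁} (id⊢ φ₂)) d
      ∙ ∘-resp-≈ʳ (∘-resp-≈ʳ (⟦id⊢⟧ φ₂) ∙ identityʳ)

    factor-∨R₁ : ∀ (d : φ ⊢ node ∨c ψ₁ ψ₂) → IsEmptyRel (targetʳ (linking d)) →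
      Σ (φ ⊢ ψ₁) λ d' → (⟦ d ⟧⊢ ≈ ι₁ ∘ ⟦ d' ⟧⊢) × (linking d' ≈R targetˡ (linking d))
    factor-∨R₁ (∨R₁ d) _ = d , ≈.refl , λ _ _ → refl
    factor-∨R₁ (∨R₂ d) empty = ⊥-elim (linking-nonempty-absurd d empty)
    factor-∨R₁ (∨L d e) empty
      with factor-∨R₁ d (λ x → empty (left x)) | factor-∨R₁ e (λ x → empty (right x))
    ... | d' , ⟦d⟧≈ , d'≈ | e' , ⟦e⟧≈ , e'≈ = ∨L d' e' ,
      coproduct-ext (inject₁ ∙ ⟦d⟧≈ ∙ ≈.sym (assoc ∙ ∘-resp-≈ʳ inject₁))
                    (inject₂ ∙ ⟦e⟧≈ ∙ ≈.sym (assoc ∙ ∘-resp-≈ʳ inject₂)) ,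
      λ { (left x) y → d'≈ x y ; (right x) y → e'≈ x y }
    factor-∨R₁ (∧L₁ d) empty with factor-∨R₁ d (λ x → empty (left x))
    ... | d' , ⟦d⟧≈ , d'≈ = ∧L₁ d' , ∘-resp-≈ˡ ⟦d⟧≈ ∙ assoc ,
      λ { (left x) y → d'≈ x y ; (right x) y → refl }
    factor-∨R₁ (∧L₂ d) empty with factor-∨R₁ d (λ x → empty (right x))
    ... | d' , ⟦d⟧≈ , d'≈ = ∧L₂ d' , ∘-resp-≈ˡ ⟦d⟧≈ ∙ assoc ,
      λ { (right x) y → d'≈ x y ; (left x) y → refl }

    factor-∨R₂ : ∀ (d : φ ⊢ node ∨c ψ₁ ψ₂) → IsEmptyRel (targetˡ (linking d)) →
      Σ (φ ⊢ ψ₂) λ d' → (⟦ d ⟧⊢ ≈ ι₂ ∘ ⟦ d' ⟧⊢) × (linking d' ≈R targetʳ (linking d))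
    factor-∨R₂ (∨R₂ d) _ = d , ≈.refl , λ _ _ → refl
    factor-∨R₂ (∨R₁ d) empty = ⊥-elim (linking-nonempty-absurd d empty)
    factor-∨R₂ (∨L d e) empty
      with factor-∨R₂ d (λ x → empty (left x)) | factor-∨R₂ e (λ x → empty (right x))
    ... | d' , ⟦d⟧≈ , d'≈ | e' , ⟦e⟧≈ , e'≈ = ∨L d' e' ,
      coproduct-ext (inject₁ ∙ ⟦d⟧≈ ∙ ≈.sym (assoc ∙ ∘-resp-≈ʳ inject₁))
                    (inject₂ ∙ ⟦e⟧≈ ∙ ≈.sym (assoc ∙ ∘-resp-≈ʳ inject₂)) ,
      λ { (left x) y → d'≈ x y ; (right x) y → e'≈ x y }
    factor-∨R₂ (∧L₁ d) empty with factor-∨R₂ d (λ x → empty (left x))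
    ... | d' , ⟦d⟧≈ , d'≈ = ∧L₁ d' , ∘-resp-≈ˡ ⟦d⟧≈ ∙ assoc ,
      λ { (left x) y → d'≈ x y ; (right x) y → refl }
    factor-∨R₂ (∧L₂ d) empty with factor-∨R₂ d (λ x → empty (right x))
    ... | d' , ⟦d⟧≈ , d'≈ = ∧L₂ d' , ∘-resp-≈ˡ ⟦d⟧≈ ∙ assoc ,
      λ { (right x) y → d'≈ x y ; (left x) y → refl }

    factor-∧L₁ : ∀ (d : node ∧c φ₁ φ₂ ⊢ ψ) → IsEmptyRel (sourceʳ (linking d)) →
      Σ (φ₁ ⊢ ψ) λ d' → (⟦ d ⟧⊢ ≈ ⟦ d' ⟧⊢ ∘ π₁) × (linking d' ≈R sourceˡ (linking d))
    factor-∧L₁ (∧L₁ d) _ = d , ≈.refl , λ _ _ → refl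
    factor-∧L₁ (∧L₂ d) empty = ⊥-elim (linking-nonempty-absurd d empty)
    factor-∧L₁ (∧R d e) empty
      with factor-∧L₁ d (λ x y → empty x (left y)) | factor-∧L₁ e (λ x y → empty x (right y))
    ... | d' , ⟦d⟧≈ , d'≈ | e' , ⟦e⟧≈ , e'≈ = ∧R d' e' ,
      product-ext (project₁ ∙ ⟦d⟧≈ ∙ ≈.sym (sym-assoc ∙ ∘-resp-≈ˡ project₁))
                  (project₂ ∙ ⟦e⟧≈ ∙ ≈.sym (sym-assoc ∙ ∘-resp-≈ˡ project₂)) ,
      λ { x (left y) → d'≈ x y ; x (right y) → e'≈ x y }
    factor-∧L₁ (∨R₁ d) empty with factor-∧L₁ d (λ x y → empty x (left y))
    ... | d' , ⟦d⟧≈ , d'≈ = ∨R₁ d' , ∘-resp-≈ʳ ⟦d⟧≈ ∙ sym-assoc ,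
      λ { x (left y) → d'≈ x y ; x (right y) → refl }
    factor-∧L₁ (∨R₂ d) empty with factor-∧L₁ d (λ x y → empty x (right y))
    ... | d' , ⟦d⟧≈ , d'≈ = ∨R₂ d' , ∘-resp-≈ʳ ⟦d⟧≈ ∙ sym-assoc ,
      λ { x (right y) → d'≈ x y ; x (left y) → refl }

    factor-∧L₂ : ∀ (d : node ∧c φ₁ φ₂ ⊢ ψ) → IsEmptyRel (sourceˡ (linking d)) →
      Σ (φ₂ ⊢ ψ) λ d' → (⟦ d ⟧⊢ ≈ ⟦ d' ⟧⊢ ∘ π₂) × (linking d' ≈R sourceʳ (linking d))
    factor-∧L₂ (∧L₂ d) _ = d , ≈.refl , λ _ _ → refl
    factor-∧L₂ (∧L₁ d) empty = ⊥-elim (linking-nonempty-absurd d empty)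
    factor-∧L₂ (∧R d e) empty
      with factor-∧L₂ d (λ x y → empty x (left y)) | factor-∧L₂ e (λ x y → empty x (right y))
    ... | d' , ⟦d⟧≈ , d'≈ | e' , ⟦e⟧≈ , e'≈ = ∧R d' e' ,
      product-ext (project₁ ∙ ⟦d⟧≈ ∙ ≈.sym (sym-assoc ∙ ∘-resp-≈ˡ project₁))
                  (project₂ ∙ ⟦e⟧≈ ∙ ≈.sym (sym-assoc ∙ ∘-resp-≈ˡ project₂)) ,
      λ { x (left y) → d'≈ x y ; x (right y) → e'≈ x y }
    factor-∧L₂ (∨R₁ d) empty with factor-∧L₂ d (λ x y → empty x (left y))
    ... | d' , ⟦d⟧≈ , d'≈ = ∨R₁ d' , ∘-resp-≈ʳ ⟦d⟧≈ ∙ sym-assoc ,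
      λ { x (left y) → d'≈ x y ; x (right y) → refl }
    factor-∧L₂ (∨R₂ d) empty with factor-∧L₂ d (λ x y → empty x (right y))
    ... | d' , ⟦d⟧≈ , d'≈ = ∨R₂ d' , ∘-resp-≈ʳ ⟦d⟧≈ ∙ sym-assoc ,
      λ { x (right y) → d'≈ x y ; x (left y) → refl }

    Coherent : Formula K → Formula K → Set _
    Coherent φ ψ = ∀ (d d' : φ ⊢ ψ) → linking d ≈R linking d' → ⟦ d ⟧⊢ ≈ ⟦ d' ⟧⊢

    coherent-∧R : Coherent φ ψ₁ → Coherent φ ψ₂ → Coherent φ (node ∧c ψ₁ ψ₂)
    coherent-∧R coh₁ coh₂ d d' same = product-ext
      (≈.sym (⟦post-π₁⟧ d) ∙ coh₁ (post-π₁ d) (post-π₁ d') linking≈ˡ ∙ ⟦post-π₁⟧ d')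
      (≈.sym (⟦post-π₂⟧ d) ∙ coh₂ (post-π₂ d) (post-π₂ d') linking≈ʳ ∙ ⟦post-π₂⟧ d')
      where
      linking≈ˡ : linking (post-π₁ d) ≈R linking (post-π₁ d')
      linking≈ˡ x y = trans (linking-post-π₁ d x y) (trans (same x (left y)) (sym (linking-post-π₁ d' x y)))
      linking≈ʳ : linking (post-π₂ d) ≈R linking (post-π₂ d')
      linking≈ʳ x y = trans (linking-post-π₂ d x y) (trans (same x (right y)) (sym (linking-post-π₂ d' x y)))

    coherent-∨L : Coherent φ₁ ψ → Coherent φ₂ ψ → Coherent (node ∨c φ₁ φ₂) ψ
    coherent-∨L coh₁ coh₂ d d' same = coproduct-ext
      (≈.sym (⟦pre-ι₁⟧ d) ∙ coh₁ (pre-ι₁ d) (pre-ι₁ d') linking≈ˡ ∙ ⟦pre-ι₁⟧ d')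
      (≈.sym (⟦pre-ι₂⟧ d) ∙ coh₂ (pre-ι₂ d) (pre-ι₂ d') linking≈ʳ ∙ ⟦pre-ι₂⟧ d')
      where
      linking≈ˡ : linking (pre-ι₁ d) ≈R linking (pre-ι₁ d')
      linking≈ˡ x y = trans (linking-pre-ι₁ d x y) (trans (same (left x) y) (sym (linking-pre-ι₁ d' x y)))
      linking≈ʳ : linking (pre-ι₂ d) ≈R linking (pre-ι₂ d')
      linking≈ʳ x y = trans (linking-pre-ι₂ d x y) (trans (same (right x) y) (sym (linking-pre-ι₂ d' x y)))

    coherent-ax : ∀ {k k' : K} → Coherent (atom k) (atom k')
    coherent-ax ax ax _ = ≈.refl

    coherent-atom-∨ : ∀ {k : K} → Coherent (atom k) ψ₁ → Coherent (atom k) ψ₂ →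
                      Coherent (atom k) (node ∨c ψ₁ ψ₂)
    coherent-atom-∨ coh₁ coh₂ (∨R₁ d) (∨R₁ d') same = ∘-resp-≈ʳ (coh₁ d d' λ x y → same x (left y))
    coherent-atom-∨ coh₁ coh₂ (∨R₂ d) (∨R₂ d') same = ∘-resp-≈ʳ (coh₂ d d' λ x y → same x (right y))
    coherent-atom-∨ coh₁ coh₂ (∨R₁ d) (∨R₂ _)  same =
      ⊥-elim (linking-nonempty-absurd d λ x y → same x (left y))
    coherent-atom-∨ coh₁ coh₂ (∨R₂ d) (∨R₁ _)  same =
      ⊥-elim (linking-nonempty-absurd d λ x y → same x (right y))

    coherent-∧-atom : ∀ {k : K} → Coherent φ₁ (atom k) → Coherent φ₂ (atom k) →
                      Coherent (node ∧c φ₁ φ₂) (atom k)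
    coherent-∧-atom coh₁ coh₂ (∧L₁ d) (∧L₁ d') same = ∘-resp-≈ˡ (coh₁ d d' λ x y → same (left x) y)
    coherent-∧-atom coh₁ coh₂ (∧L₂ d) (∧L₂ d') same = ∘-resp-≈ˡ (coh₂ d d' λ x y → same (right x) y)
    coherent-∧-atom coh₁ coh₂ (∧L₁ d) (∧L₂ _)  same =
      ⊥-elim (linking-nonempty-absurd d λ x y → same (left x) y)
    coherent-∧-atom coh₁ coh₂ (∧L₂ d) (∧L₁ _)  same =
      ⊥-elim (linking-nonempty-absurd d λ x y → same (right x) y)

    coherent-∧L₁-∨R₁ : Coherent φ₁ ψ₁ → ∀ (d : φ₁ ⊢ node ∨c ψ₁ ψ₂) (d' : node ∧c φ₁ φ₂ ⊢ ψ₁) →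
      linking (∧L₁ {φ₂ = φ₂} d) ≈R linking (∨R₁ {ψ₂ = ψ₂} d') → ⟦ d ⟧⊢ ∘ π₁ ≈ ι₁ ∘ ⟦ d' ⟧⊢
    coherent-∧L₁-∨R₁ coh d d' same
      with factor-∨R₁ d (λ x y → same (left x) (right y))
         | factor-∧L₁ d' (λ x y → sym (same (right x) (left y)))
    ... | e , ⟦d⟧≈ , e≈ | e' , ⟦d'⟧≈ , e'≈ = ∘-resp-factorisations ⟦d⟧≈ ⟦d'⟧≈
      (coh e e' λ x y → trans (e≈ x y) (trans (same (left x) (left y)) (sym (e'≈ x y))))

    coherent-∧L₁-∨R₂ : Coherent φ₁ ψ₂ → ∀ (d : φ₁ ⊢ node ∨c ψ₁ ψ₂) (d' : node ∧c φ₁ φ₂ ⊢ ψ₂) →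
      linking (∧L₁ {φ₂ = φ₂} d) ≈R linking (∨R₂ {ψ₁ = ψ₁} d') → ⟦ d ⟧⊢ ∘ π₁ ≈ ι₂ ∘ ⟦ d' ⟧⊢
    coherent-∧L₁-∨R₂ coh d d' same
      with factor-∨R₂ d (λ x y → same (left x) (left y))
         | factor-∧L₁ d' (λ x y → sym (same (right x) (right y)))
    ... | e , ⟦d⟧≈ , e≈ | e' , ⟦d'⟧≈ , e'≈ = ∘-resp-factorisations ⟦d⟧≈ ⟦d'⟧≈
      (coh e e' λ x y → trans (e≈ x y) (trans (same (left x) (right y)) (sym (e'≈ x y))))

    coherent-∧L₂-∨R₁ : Coherent φ₂ ψ₁ → ∀ (d : φ₂ ⊢ node ∨c ψ₁ ψ₂) (d' : node ∧c φ₁ φ₂ ⊢ ψ₁) →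
      linking (∧L₂ {φ₁ = φ₁} d) ≈R linking (∨R₁ {ψ₂ = ψ₂} d') → ⟦ d ⟧⊢ ∘ π₂ ≈ ι₁ ∘ ⟦ d' ⟧⊢
    coherent-∧L₂-∨R₁ coh d d' same
      with factor-∨R₁ d (λ x y → same (right x) (right y))
         | factor-∧L₂ d' (λ x y → sym (same (left x) (left y)))
    ... | e , ⟦d⟧≈ , e≈ | e' , ⟦d'⟧≈ , e'≈ = ∘-resp-factorisations ⟦d⟧≈ ⟦d'⟧≈
      (coh e e' λ x y → trans (e≈ x y) (trans (same (right x) (left y)) (sym (e'≈ x y))))

    coherent-∧L₂-∨R₂ : Coherent φ₂ ψ₂ → ∀ (d : φ₂ ⊢ node ∨c ψ₁ ψ₂) (d' : node ∧c φ₁ φ₂ ⊢ ψ₂) →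
      linking (∧L₂ {φ₁ = φ₁} d) ≈R linking (∨R₂ {ψ₁ = ψ₁} d') → ⟦ d ⟧⊢ ∘ π₂ ≈ ι₂ ∘ ⟦ d' ⟧⊢
    coherent-∧L₂-∨R₂ coh d d' same
      with factor-∨R₂ d (λ x y → same (right x) (left y))
         | factor-∧L₂ d' (λ x y → sym (same (left x) (right y)))
    ... | e , ⟦d⟧≈ , e≈ | e' , ⟦d'⟧≈ , e'≈ = ∘-resp-factorisations ⟦d⟧≈ ⟦d'⟧≈
      (coh e e' λ x y → trans (e≈ x y) (trans (same (right x) (right y)) (sym (e'≈ x y))))

    module _ (cohˡ : Coherent φ₁ (node ∨c ψ₁ ψ₂)) (cohʳ : Coherent φ₂ (node ∨c ψ₁ ψ₂))
             (coh₁ : Coherent (node ∧c φ₁ φ₂) ψ₁) (coh₂ : Coherent (node ∧c φ₁ φ₂) ψ₂)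
             (coh₁₁ : Coherent φ₁ ψ₁) (coh₁₂ : Coherent φ₁ ψ₂)
             (coh₂₁ : Coherent φ₂ ψ₁) (coh₂₂ : Coherent φ₂ ψ₂) where

      coherent-∧-∨ : Coherent (node ∧c φ₁ φ₂) (node ∨c ψ₁ ψ₂)
      coherent-∧-∨ (∧L₁ d) (∧L₁ d') same = ∘-resp-≈ˡ (cohˡ d d' λ x y → same (left x) y)
      coherent-∧-∨ (∧L₂ d) (∧L₂ d') same = ∘-resp-≈ˡ (cohʳ d d' λ x y → same (right x) y)
      coherent-∧-∨ (∨R₁ d) (∨R₁ d') same = ∘-resp-≈ʳ (coh₁ d d' λ x y → same x (left y))
      coherent-∧-∨ (∨R₂ d) (∨R₂ d') same = ∘-resp-≈ʳ (coh₂ d d' λ x y → same x (right y))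
      coherent-∧-∨ (∧L₁ d) (∧L₂ _) same = ⊥-elim (linking-nonempty-absurd d λ x y → same (left x) y)
      coherent-∧-∨ (∧L₂ d) (∧L₁ _) same = ⊥-elim (linking-nonempty-absurd d λ x y → same (right x) y)
      coherent-∧-∨ (∨R₁ d) (∨R₂ _) same = ⊥-elim (linking-nonempty-absurd d λ x y → same x (left y))
      coherent-∧-∨ (∨R₂ d) (∨R₁ _) same = ⊥-elim (linking-nonempty-absurd d λ x y → same x (right y))
      coherent-∧-∨ (∧L₁ d) (∨R₁ d') same = coherent-∧L₁-∨R₁ coh₁₁ d d' same
      coherent-∧-∨ (∧L₁ d) (∨R₂ d') same = coherent-∧L₁-∨R₂ coh₁₂ d d' same
      coherent-∧-∨ (∧L₂ d) (∨R₁ d') same = coherent-∧L₂-∨R₁ coh₂₁ d d' same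
      coherent-∧-∨ (∧L₂ d) (∨R₂ d') same = coherent-∧L₂-∨R₂ coh₂₂ d d' same
      coherent-∧-∨ (∨R₁ d') (∧L₁ d) same = ≈.sym (coherent-∧L₁-∨R₁ coh₁₁ d d' λ x y → sym (same x y))
      coherent-∧-∨ (∨R₂ d') (∧L₁ d) same = ≈.sym (coherent-∧L₁-∨R₂ coh₁₂ d d' λ x y → sym (same x y))
      coherent-∧-∨ (∨R₁ d') (∧L₂ d) same = ≈.sym (coherent-∧L₂-∨R₁ coh₂₁ d d' λ x y → sym (same x y))
      coherent-∧-∨ (∨R₂ d') (∧L₂ d) same = ≈.sym (coherent-∧L₂-∨R₂ coh₂₂ d d' λ x y → sym (same x y))

    coherence : ∀ (φ ψ : Formula K) → Coherent φ ψ
    coherence φ (node ∧c ψ₁ ψ₂) = coherent-∧R (coherence φ ψ₁) (coherence φ ψ₂)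
    coherence (node ∨c φ₁ φ₂) ψ = coherent-∨L (coherence φ₁ ψ) (coherence φ₂ ψ)
    coherence (atom k) (atom k') = coherent-ax
    coherence (atom k) (node ∨c ψ₁ ψ₂) =
      coherent-atom-∨ (coherence (atom k) ψ₁) (coherence (atom k) ψ₂)
    coherence (node ∧c φ₁ φ₂) (atom k) =
      coherent-∧-atom (coherence φ₁ (atom k)) (coherence φ₂ (atom k))
    coherence (node ∧c φ₁ φ₂) (node ∨c ψ₁ ψ₂) = coherent-∧-∨
      (coherence φ₁ (node ∨c ψ₁ ψ₂)) (coherence φ₂ (node ∨c ψ₁ ψ₂))
      (coherence (node ∧c φ₁ φ₂) ψ₁) (coherence (node ∧c φ₁ φ₂) ψ₂)
      (coherence φ₁ ψ₁) (coherence φ₁ ψ₂) (coherence φ₂ ψ₁) (coherence φ₂ ψ₂)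

  -- Freeness

  homOf : φ ⊢ ψ → Hom φ ψ
  homOf d = record
    { rel     = linking d
    ; labels  = linking-respectsLabels d
    ; resCond = ResolutionCondition′⇒ResolutionCondition (linking-resCond d) }

  derivationOf : ∀ (f : Hom φ ψ) → DerivationOf (rel f)
  derivationOf {φ = φ} {ψ = ψ} f =
    sequentialise φ ψ (rel f) (ResolutionCondition⇒ResolutionCondition′ (resCond f)) (labels f)

  ∧-π₁ : ∀ φ ψ → Hom (node ∧c φ ψ) φ
  ∧-π₁ φ ψ = homOf (∧L₁ (id⊢ φ))

  ∧-π₂ : ∀ φ ψ → Hom (node ∧c φ ψ) ψ
  ∧-π₂ φ ψ = homOf (∧L₂ (id⊢ ψ))

  ∨-ι₁ : ∀ φ ψ → Hom φ (node ∨c φ ψ)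
  ∨-ι₁ φ ψ = homOf (∨R₁ (id⊢ φ))

  ∨-ι₂ : ∀ φ ψ → Hom ψ (node ∨c φ ψ)
  ∨-ι₂ φ ψ = homOf (∨R₂ (id⊢ ψ))

  compRel-via′ : ∀ (R : Rel φ ψ) (R' : Rel ψ χ) {S : Rel φ χ} → compRel′ R R' ≈R S → compRel R R' ≈R S
  compRel-via′ R R' eq x z = trans (compRel≈compRel′ R R' x z) (eq x z)

  compRel-π₁ : ∀ (R : Rel χ (node ∧c ψ₁ ψ₂)) → compRel R (rel (∧-π₁ ψ₁ ψ₂)) ≈R targetˡ R
  compRel-π₁ R = compRel-via′ R _ (compRel′-π₁ R)

  compRel-π₂ : ∀ (R : Rel χ (node ∧c ψ₁ ψ₂)) → compRel R (rel (∧-π₂ ψ₁ ψ₂)) ≈R targetʳ R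
  compRel-π₂ R = compRel-via′ R _ (compRel′-π₂ R)

  compRel-ι₁ : ∀ (R : Rel (node ∨c φ₁ φ₂) χ) → compRel (rel (∨-ι₁ φ₁ φ₂)) R ≈R sourceˡ R
  compRel-ι₁ R = compRel-via′ _ R (compRel′-ι₁ R)

  compRel-ι₂ : ∀ (R : Rel (node ∨c φ₁ φ₂) χ) → compRel (rel (∨-ι₂ φ₁ φ₂)) R ≈R sourceʳ R
  compRel-ι₂ R = compRel-via′ _ R (compRel′-ι₂ R)

  compRel-π₁-pre : ∀ (R : Rel φ₁ χ) → compRel (rel (∧-π₁ φ₁ φ₂)) R ≈R joinSource R emptyRel
  compRel-π₁-pre R = compRel-via′ _ R (compRel′-π₁-pre R)

  compRel-π₂-pre : ∀ (R : Rel φ₂ χ) → compRel (rel (∧-π₂ φ₁ φ₂)) R ≈R joinSource emptyRel R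
  compRel-π₂-pre R = compRel-via′ _ R (compRel′-π₂-pre R)

  compRel-ι₁-post : ∀ (R : Rel χ ψ₁) → compRel R (rel (∨-ι₁ ψ₁ ψ₂)) ≈R joinTarget R emptyRel
  compRel-ι₁-post R = compRel-via′ R _ (compRel′-ι₁-post R)

  compRel-ι₂-post : ∀ (R : Rel χ ψ₂) → compRel R (rel (∨-ι₂ ψ₁ ψ₂)) ≈R joinTarget emptyRel R
  compRel-ι₂-post R = compRel-via′ R _ (compRel′-ι₂-post R)

  CW-isProduct : ∀ φ ψ → IsProduct CWK (∧-π₁ φ ψ) (∧-π₂ φ ψ)
  CW-isProduct φ ψ f g =
    let (d , d≈) = derivationOf f
        (e , e≈) = derivationOf g
    in homOf (∧R d e) ,
       (λ x y → trans (compRel-π₁ (linking (∧R d e)) x y) (d≈ x y)) ,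
       (λ x y → trans (compRel-π₂ (linking (∧R d e)) x y) (e≈ x y)) ,
       λ h eq₁ eq₂ → λ
         { x (left y)  → trans (sym (compRel-π₁ (rel h) x y)) (trans (eq₁ x y) (sym (d≈ x y)))
         ; x (right y) → trans (sym (compRel-π₂ (rel h) x y)) (trans (eq₂ x y) (sym (e≈ x y))) }

  CW-isCoproduct : ∀ φ ψ → IsCoproduct CWK (∨-ι₁ φ ψ) (∨-ι₂ φ ψ)
  CW-isCoproduct φ ψ f g =
    let (d , d≈) = derivationOf f
        (e , e≈) = derivationOf g
    in homOf (∨L d e) ,
       (λ x y → trans (compRel-ι₁ (linking (∨L d e)) x y) (d≈ x y)) ,
       (λ x y → trans (compRel-ι₂ (linking (∨L d e)) x y) (e≈ x y)) ,
       λ h eq₁ eq₂ → λ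
         { (left x)  y → trans (sym (compRel-ι₁ (rel h) x y)) (trans (eq₁ x y) (sym (d≈ x y)))
         ; (right x) y → trans (sym (compRel-ι₂ (rel h) x y)) (trans (eq₂ x y) (sym (e≈ x y))) }

  CW-products : HasBinaryProducts CWK
  CW-products φ ψ = node ∧c φ ψ , ∧-π₁ φ ψ , ∧-π₂ φ ψ , CW-isProduct φ ψ

  CW-coproducts : HasBinaryCoproducts CWK
  CW-coproducts φ ψ = node ∨c φ ψ , ∨-ι₁ φ ψ , ∨-ι₂ φ ψ , CW-isCoproduct φ ψ

  module Freeness (C : Category o ℓ e) (products : HasBinaryProducts C)
                  (coproducts : HasBinaryCoproducts C) where
    open CategoryProperties C
    private
      module Cᵒᵖ = CategoryProperties (op C)
      module W = Category CWK

    module _ (gen₀ : K → Obj) where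
      open Interpretation C products coproducts gen₀
      open Coherence C products coproducts gen₀

      ⟦_⟧₁ : Hom φ ψ → ⟦ φ ⟧ ⇒ ⟦ ψ ⟧
      ⟦ f ⟧₁ = ⟦ proj₁ (derivationOf f) ⟧⊢

      ⟦⟧₁-linking : ∀ (f : Hom φ ψ) (d : φ ⊢ ψ) → linking d ≈R rel f → ⟦ f ⟧₁ ≈ ⟦ d ⟧⊢
      ⟦⟧₁-linking {φ = φ} {ψ = ψ} f d d≈f =
        let (s , s≈f) = derivationOf f in coherence φ ψ s d λ x y → trans (s≈f x y) (sym (d≈f x y))

      interpretationFunctor : Functor CWK C
      interpretationFunctor = record
        { F₀ = ⟦_⟧
        ; F₁ = ⟦_⟧₁
        ; F-resp-≈ = λ {_} {_} {f} {g} f≈g →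
            let (s , s≈g) = derivationOf g in ⟦⟧₁-linking f s λ x y → trans (s≈g x y) (sym (f≈g x y))
        ; identity = λ {φ} → ⟦⟧₁-linking W.id (id⊢ φ) (linking-id⊢ φ) ∙ ⟦id⊢⟧ φ
        ; homomorphism = λ {_} {_} {_} {f} {g} →
            let (s , s≈f) = derivationOf f
                (t , t≈g) = derivationOf g
            in ⟦⟧₁-linking (g W.∘ f) (cut s t)
                 (λ x z → trans (linking-cut s t x z)
                            (trans (compRel′-cong s≈f t≈g x z) (sym (compRel≈compRel′ (rel f) (rel g) x z))))
               ∙ ⟦cut⟧ s t
        }

      interpretation : PPFunctor CWK C
      interpretation = record
        { functor     = interpretationFunctor
        ; pres-prod   = λ {_} {_} {_} {π₁′} {π₂′} →
            FunctorProperties.preservesProducts interpretationFunctor CW-products preserves-∧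
              {q₁ = π₁′} {q₂ = π₂′}
        ; pres-coprod = λ {_} {_} {_} {ι₁′} {ι₂′} →
            FunctorProperties.preservesProducts (op-functor interpretationFunctor) CW-coproducts preserves-∨
              {q₁ = ι₁′} {q₂ = ι₂′}
        }
        where
        preserves-∧ : ∀ φ ψ → IsProduct C ⟦ ∧-π₁ φ ψ ⟧₁ ⟦ ∧-π₂ φ ψ ⟧₁
        preserves-∧ φ ψ = IsProduct-resp-≈ (×-isProduct ⟦ φ ⟧ ⟦ ψ ⟧)
          (≈.sym (⟦⟧₁-linking (∧-π₁ φ ψ) (∧L₁ (id⊢ φ)) (λ _ _ → refl) ∙ ∘-resp-≈ˡ (⟦id⊢⟧ φ) ∙ identityˡ))
          (≈.sym (⟦⟧₁-linking (∧-π₂ φ ψ) (∧L₂ (id⊢ ψ)) (λ _ _ → refl) ∙ ∘-resp-≈ˡ (⟦id⊢⟧ ψ) ∙ identityˡ))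
        preserves-∨ : ∀ φ ψ → IsCoproduct C ⟦ ∨-ι₁ φ ψ ⟧₁ ⟦ ∨-ι₂ φ ψ ⟧₁
        preserves-∨ φ ψ = Cᵒᵖ.IsProduct-resp-≈ (+-isCoproduct ⟦ φ ⟧ ⟦ ψ ⟧)
          (≈.sym (⟦⟧₁-linking (∨-ι₁ φ ψ) (∨R₁ (id⊢ φ)) (λ _ _ → refl) ∙ ∘-resp-≈ʳ (⟦id⊢⟧ φ) ∙ identityʳ))
          (≈.sym (⟦⟧₁-linking (∨-ι₂ φ ψ) (∨R₂ (id⊢ ψ)) (λ _ _ → refl) ∙ ∘-resp-≈ʳ (⟦id⊢⟧ ψ) ∙ identityʳ))

    module _ (F F' : PPFunctor CWK C) where
      private
        module F  = PPFunctor F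
        module F' = PPFunctor F'

      F'-isProduct : ∀ φ ψ → IsProduct C (F'.F₁ (∧-π₁ φ ψ)) (F'.F₁ (∧-π₂ φ ψ))
      F'-isProduct φ ψ = F'.pres-prod (CW-isProduct φ ψ)

      F-isCoproduct : ∀ φ ψ → IsCoproduct C (F.F₁ (∨-ι₁ φ ψ)) (F.F₁ (∨-ι₂ φ ψ))
      F-isCoproduct φ ψ = F.pres-coprod (CW-isCoproduct φ ψ)

      NatTrans-ext : ∀ (α β : NatTrans F F') → (∀ k → η α (atom k) ≈ η β (atom k)) → ∀ φ → η α φ ≈ η β φ
      NatTrans-ext α β agree (atom k) = agree k
      NatTrans-ext α β agree (node ∧c φ ψ) = IsProduct-ext (F'-isProduct φ ψ) _ _
        (≈.sym (commute α (∧-π₁ φ ψ)) ∙ ∘-resp-≈ˡ (NatTrans-ext α β agree φ) ∙ commute β (∧-π₁ φ ψ))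
        (≈.sym (commute α (∧-π₂ φ ψ)) ∙ ∘-resp-≈ˡ (NatTrans-ext α β agree ψ) ∙ commute β (∧-π₂ φ ψ))
      NatTrans-ext α β agree (node ∨c φ ψ) = Cᵒᵖ.IsProduct-ext (F-isCoproduct φ ψ) _ _
        (commute α (∨-ι₁ φ ψ) ∙ ∘-resp-≈ʳ (NatTrans-ext α β agree φ) ∙ ≈.sym (commute β (∨-ι₁ φ ψ)))
        (commute α (∨-ι₂ φ ψ) ∙ ∘-resp-≈ʳ (NatTrans-ext α β agree ψ) ∙ ≈.sym (commute β (∨-ι₂ φ ψ)))

      module Extension (h : ∀ k → F.F₀ (atom k) ⇒ F'.F₀ (atom k)) where

        extend : ∀ φ → F.F₀ φ ⇒ F'.F₀ φ
        extend (atom k)      = h k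
        extend (node ∧c φ ψ) =
          proj₁ (F'-isProduct φ ψ (extend φ ∘ F.F₁ (∧-π₁ φ ψ)) (extend ψ ∘ F.F₁ (∧-π₂ φ ψ)))
        extend (node ∨c φ ψ) =
          proj₁ (F-isCoproduct φ ψ (F'.F₁ (∨-ι₁ φ ψ) ∘ extend φ) (F'.F₁ (∨-ι₂ φ ψ) ∘ extend ψ))

        record Natural (f : Hom φ ψ) : Set e where
          constructor natural
          field commutes : extend ψ ∘ F.F₁ f ≈ F'.F₁ f ∘ extend φ
        open Natural

        Natural-resp-≈ : ∀ {f g : Hom φ ψ} → f W.≈ g → Natural f → Natural g
        Natural-resp-≈ {f = f} {g} f≈g (natural square) = natural
          (∘-resp-≈ʳ (F.F-resp-≈ {f = g} {g = f} λ x y → sym (f≈g x y)) ∙ square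
           ∙ ∘-resp-≈ˡ (F'.F-resp-≈ {f = f} {g = g} f≈g))

        Natural-id : Natural (W.id {φ})
        Natural-id = natural
          (∘-resp-≈ʳ F.identity ∙ identityʳ ∙ ≈.sym identityˡ ∙ ∘-resp-≈ˡ (≈.sym F'.identity))

        Natural-∘ : ∀ {f : Hom φ ψ} {g : Hom ψ χ} → Natural f → Natural g → Natural (g W.∘ f)
        Natural-∘ {f = f} {g} (natural square-f) (natural square-g) = natural
          (∘-resp-≈ʳ (F.homomorphism {f = f} {g = g}) ∙ sym-assoc ∙ ∘-resp-≈ˡ square-g ∙ assoc
           ∙ ∘-resp-≈ʳ square-f ∙ sym-assoc ∙ ∘-resp-≈ˡ (≈.sym (F'.homomorphism {f = f} {g = g})))

        extend-project₁ : F'.F₁ (∧-π₁ φ ψ) ∘ extend (node ∧c φ ψ) ≈ extend φ ∘ F.F₁ (∧-π₁ φ ψ)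
        extend-project₁ {φ = φ} {ψ = ψ} =
          proj₁ (proj₂ (F'-isProduct φ ψ (extend φ ∘ F.F₁ (∧-π₁ φ ψ)) (extend ψ ∘ F.F₁ (∧-π₂ φ ψ))))

        extend-project₂ : F'.F₁ (∧-π₂ φ ψ) ∘ extend (node ∧c φ ψ) ≈ extend ψ ∘ F.F₁ (∧-π₂ φ ψ)
        extend-project₂ {φ = φ} {ψ = ψ} =
          proj₁ (proj₂ (proj₂ (F'-isProduct φ ψ (extend φ ∘ F.F₁ (∧-π₁ φ ψ)) (extend ψ ∘ F.F₁ (∧-π₂ φ ψ)))))

        extend-inject₁ : extend (node ∨c φ ψ) ∘ F.F₁ (∨-ι₁ φ ψ) ≈ F'.F₁ (∨-ι₁ φ ψ) ∘ extend φ
        extend-inject₁ {φ = φ} {ψ = ψ} =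
          proj₁ (proj₂ (F-isCoproduct φ ψ (F'.F₁ (∨-ι₁ φ ψ) ∘ extend φ) (F'.F₁ (∨-ι₂ φ ψ) ∘ extend ψ)))

        extend-inject₂ : extend (node ∨c φ ψ) ∘ F.F₁ (∨-ι₂ φ ψ) ≈ F'.F₁ (∨-ι₂ φ ψ) ∘ extend ψ
        extend-inject₂ {φ = φ} {ψ = ψ} =
          proj₁ (proj₂ (proj₂ (F-isCoproduct φ ψ (F'.F₁ (∨-ι₁ φ ψ) ∘ extend φ) (F'.F₁ (∨-ι₂ φ ψ) ∘ extend ψ))))

        Natural-cancelˡ : ∀ {f : Hom φ ψ} {p : Hom ψ χ} → Natural p → Natural (p W.∘ f) →
                          F'.F₁ p ∘ (extend ψ ∘ F.F₁ f) ≈ F'.F₁ p ∘ (F'.F₁ f ∘ extend φ)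
        Natural-cancelˡ {f = f} {p} (natural square-p) (natural square-pf) =
          sym-assoc ∙ ∘-resp-≈ˡ (≈.sym square-p) ∙ assoc ∙ ∘-resp-≈ʳ (≈.sym (F.homomorphism {f = f} {g = p}))
          ∙ square-pf ∙ ∘-resp-≈ˡ (F'.homomorphism {f = f} {g = p}) ∙ assoc

        Natural-cancelʳ : ∀ {i : Hom φ ψ} {f : Hom ψ χ} → Natural i → Natural (f W.∘ i) →
                          (extend χ ∘ F.F₁ f) ∘ F.F₁ i ≈ (F'.F₁ f ∘ extend ψ) ∘ F.F₁ i
        Natural-cancelʳ {i = i} {f} (natural square-i) (natural square-fi) =
          assoc ∙ ∘-resp-≈ʳ (≈.sym (F.homomorphism {f = i} {g = f})) ∙ square-fi
          ∙ ∘-resp-≈ˡ (F'.homomorphism {f = i} {g = f}) ∙ assoc ∙ ∘-resp-≈ʳ (≈.sym square-i) ∙ sym-assoc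

        Natural-into-∧ : ∀ {f : Hom χ (node ∧c φ ψ)} →
          Natural (∧-π₁ φ ψ W.∘ f) → Natural (∧-π₂ φ ψ W.∘ f) → Natural f
        Natural-into-∧ {χ = χ} {φ = φ} {ψ = ψ} {f} natural₁ natural₂ = natural
          (IsProduct-ext (F'-isProduct φ ψ) (extend (node ∧c φ ψ) ∘ F.F₁ f) (F'.F₁ f ∘ extend χ)
            (Natural-cancelˡ (natural (≈.sym extend-project₁)) natural₁)
            (Natural-cancelˡ (natural (≈.sym extend-project₂)) natural₂))

        Natural-from-∨ : ∀ {f : Hom (node ∨c φ ψ) χ} →
          Natural (f W.∘ ∨-ι₁ φ ψ) → Natural (f W.∘ ∨-ι₂ φ ψ) → Natural f
        Natural-from-∨ {φ = φ} {ψ = ψ} {χ = χ} {f} natural₁ natural₂ = natural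
          (Cᵒᵖ.IsProduct-ext (F-isCoproduct φ ψ) (extend χ ∘ F.F₁ f) (F'.F₁ f ∘ extend (node ∨c φ ψ))
            (Natural-cancelʳ (natural extend-inject₁) natural₁)
            (Natural-cancelʳ (natural extend-inject₂) natural₂))

        Natural-homOf : ∀ (d : φ ⊢ ψ) → Natural (homOf d)
        Natural-homOf ax = Natural-resp-≈ (λ { here here → refl }) Natural-id
        Natural-homOf (∧R d₁ d₂) = Natural-into-∧
          (Natural-resp-≈ (λ x y → sym (compRel-π₁ (linking (∧R d₁ d₂)) x y)) (Natural-homOf d₁))
          (Natural-resp-≈ (λ x y → sym (compRel-π₂ (linking (∧R d₁ d₂)) x y)) (Natural-homOf d₂))
        Natural-homOf (∨L d₁ d₂) = Natural-from-∨
          (Natural-resp-≈ (λ x y → sym (compRel-ι₁ (linking (∨L d₁ d₂)) x y)) (Natural-homOf d₁))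
          (Natural-resp-≈ (λ x y → sym (compRel-ι₂ (linking (∨L d₁ d₂)) x y)) (Natural-homOf d₂))
        Natural-homOf (∧L₁ d) = Natural-resp-≈ (compRel-π₁-pre (linking d))
          (Natural-∘ (natural (≈.sym extend-project₁)) (Natural-homOf d))
        Natural-homOf (∧L₂ d) = Natural-resp-≈ (compRel-π₂-pre (linking d))
          (Natural-∘ (natural (≈.sym extend-project₂)) (Natural-homOf d))
        Natural-homOf (∨R₁ d) = Natural-resp-≈ (compRel-ι₁-post (linking d))
          (Natural-∘ (Natural-homOf d) (natural extend-inject₁))
        Natural-homOf (∨R₂ d) = Natural-resp-≈ (compRel-ι₂-post (linking d))
          (Natural-∘ (Natural-homOf d) (natural extend-inject₂))

        extension : NatTrans F F'
        extension = record
          { η       = extend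
          ; commute = λ f → let (d , d≈f) = derivationOf f in
              commutes (Natural-resp-≈ d≈f (Natural-homOf d)) }

theorem1 : ∀ {o ℓ e : Level} (K : Set) →
    Σ (CWFacts K) (λ fc → IsFreeProdCoprod o ℓ e (CW K fc) gen)
theorem1 K = cwFacts , CW-products , CW-coproducts , λ C products coproducts →
  let open Freeness C products coproducts
      open CategoryProperties C using (Iso-refl; module ≈)
  in (λ gen₀ → interpretation gen₀ , λ k → Iso-refl) ,
     (λ F F' h → Extension.extension F F' h , λ k → ≈.refl) ,
     NatTrans-ext
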